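{- Let $A=\{a_1,\ldots,a_d\}$ with $a_1<\cdots<a_d$ positive integers. Then $$C_{peak}^A(x,y,z)=\frac{1+\sum_{j\ge 1}M^{2j}(A) (1-y)^j}{1+\sum_{j\ge 1}M^{2j}(A) (1-y)^j-\sum_{j\ge 0}M^{2j+1}(A) (1-y)^{j}}$$ and $$C_{valley}^A(x,y,z)=\frac{1+\sum_{j\ge 1}M^{2j}(A) (1-y)^{j}}{1+\sum_{j\ge 1}M^{2j}(A)(1-y)^{j}-\sum_{j\ge 0}N^{2j+1}(A) (1-y)^{j}}.$$
   Context: A composition with parts in $A$ is a finite sequence $\sigma=\sigma_1\cdots\sigma_m$ ($m\ge0$, empty included) of elements of $A$; $n(\sigma)$ is the sum of parts and $m(\sigma)=m$. A peak of $\sigma$ is an index $i$, $1\le i\le m-2$, with $\sigma_i<\sigma_{i+1}>\sigma_{i+2}$ (i.e. an occurrence of one of the patterns $121,132,231$); a valley is an index $i$ with $\sigma_i>\sigma_{i+1}<\sigma_{i+2}$ (an occurrence of $212,213,312$). $C_{peak}^A(x,y,z)=\sum_\sigma x^{n(\sigma)}y^{\#\text{peaks}(\sigma)}z^{m(\sigma)}$ and $C_{valley}^A(x,y,z)=\sum_\sigma x^{n(\sigma)}y^{\#\text{valleys}(\sigma)}z^{m(\sigma)}$, summing over all compositions with parts in $A$. For $s\ge1$: $P^s(A)$ is the set of tuples $(i_1,\ldots,i_s)\in\{1,\ldots,d\}^s$ such that $i_{2\ell-1}<i_{2\ell}$ and $i_{2\ell}\le i_{2\ell+1}$ for all $\ell\ge1$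 for which the indices involved are at most $s$; $Q^s(A)$ is the set of tuples $(i_1,\ldots,i_s)\in\{1,\ldots,d\}^s$ such that $i_{2\ell-1}\le i_{2\ell}$ and $i_{2\ell}< i_{2\ell+1}$ for all such $\ell$. Then $M^s(A)=\sum_{(i_1,\ldots,i_s)\in P^s(A)} z^{s}\prod_{j=1}^s x^{a_{i_j}}$ and $N^s(A)=\sum_{(i_1,\ldots,i_s)\in Q^s(A)} z^{s}\prod_{j=1}^s x^{a_{i_j}}$. -}

module Defs where

open import Data.Nat as ℕ using (ℕ; zero; suc; _∸_; _<?_; _≤?_; _≟_)
open import Data.Integer as ℤ using (ℤ; +_)
open import Data.Fin as Fin using (Fin)
open import Data.Fin.Properties using () renaming (_<?_ to _<ᶠ?_; _≤?_ to _≤ᶠ?_)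
open import Data.List using (List; []; _∷_; map; concatMap; upTo; length; filter; foldr)
import Data.Bool as B
open import Data.Bool using (Bool; true; false; _∧_; not; if_then_else_)
open import Relation.Nullary using (does)
open import Relation.Nullary.Decidable using (_×-dec_)
open import Relation.Binary.PropositionalEquality using (_≡_)

-- Formal power series in x, y, z with integer coefficients:
-- f n k m = coefficient of x^n y^k z^m.

Series : Set
Series = ℕ → ℕ → ℕ → ℤ

_≈ₛ_ : Series → Series → Set
f ≈ₛ g = ∀ n k m → f n k m ≡ g n k m

sumTo : ℕ → (ℕ → ℤ) → ℤ
sumTo n f = foldr (λ i acc → f i ℤ.+ acc) (+ 0) (upTo (suc n))

oneₛ : Series
oneₛ zero zero zero = + 1
oneₛ _ _ _ = + 0

oneMinusY : Series
oneMinusY zero zero zero = + 1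
oneMinusY zero (suc zero) zero = ℤ.- (+ 1)
oneMinusY _ _ _ = + 0

_+ₛ_ : Series → Series → Series
(f +ₛ g) n k m = f n k m ℤ.+ g n k m

_-ₛ_ : Series → Series → Series
(f -ₛ g) n k m = f n k m ℤ.- g n k m

_*ₛ_ : Series → Series → Series
(f *ₛ g) n k m =
  sumTo n λ n₁ → sumTo k λ k₁ → sumTo m λ m₁ →
    f n₁ k₁ m₁ ℤ.* g (n ∸ n₁) (k ∸ k₁) (m ∸ m₁)

_^ₛ_ : Series → ℕ → Series
f ^ₛ zero = oneₛ
f ^ₛ suc j = f *ₛ (f ^ₛ j)

-- Infinite sum Σ_{j≥0} F j of a family in which F j is divisible by z^j
-- (every family used below has this property), so the coefficient of
-- z^m only receives contributions from j ≤ m.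
Σₛ : (ℕ → Series) → Series
Σₛ F n k m = sumTo m λ j → F j n k m

words : (d m : ℕ) → List (List (Fin d))
words d zero = [] ∷ []
words d (suc m) = concatMap (λ w → map (_∷ w) (Data.List.allFin d)) (words d m)
  where import Data.List

sumℕ : List ℕ → ℕ
sumℕ = foldr ℕ._+_ 0

peaks : List ℕ → ℕ
peaks (a ∷ b ∷ c ∷ r) =
  (if does (a <? b) ∧ does (c <? b) then 1 else 0) ℕ.+ peaks (b ∷ c ∷ r)
peaks _ = 0

valleys : List ℕ → ℕ
valleys (a ∷ b ∷ c ∷ r) =
  (if does (b <? a) ∧ does (b <? c) then 1 else 0) ℕ.+ valleys (b ∷ c ∷ r)
valleys _ = 0

compositions : {d : ℕ} → (Fin d → ℕ) → ℕ → List (List ℕ)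
compositions {d} a m = map (map a) (words d m)

Cstat : (List ℕ → ℕ) → {d : ℕ} → (Fin d → ℕ) → Series
Cstat stat a n k m =
  + length (filter (λ σ → (sumℕ σ ≟ n) ×-dec (stat σ ≟ k)) (compositions a m))

Cpeak : {d : ℕ} → (Fin d → ℕ) → Series
Cpeak = Cstat peaks

Cvalley : {d : ℕ} → (Fin d → ℕ) → Series
Cvalley = Cstat valleys

altOK : {d : ℕ} → Bool → List (Fin d) → Bool
altOK strict (i ∷ j ∷ r) =
  (if strict then does (i <ᶠ? j) else does (i ≤ᶠ? j)) ∧ altOK (not strict) (j ∷ r)
altOK _ _ = true

-- P^s: i₁ < i₂ ≤ i₃ < i₄ ≤ …   (starts strict)
inP : {d : ℕ} → List (Fin d) → Bool
inP = altOK true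

-- Q^s: i₁ ≤ i₂ < i₃ ≤ i₄ < …   (starts weak)
inQ : {d : ℕ} → List (Fin d) → Bool
inQ = altOK false

tupleSeries : ({d : ℕ} → List (Fin d) → Bool) → {d : ℕ} → (Fin d → ℕ) → ℕ → Series
tupleSeries p {d} a s n zero m =
  if does (m ≟ s)
  then + length (filter (λ t → (sumℕ (map a t) ≟ n)) (filter (λ t → p t B.≟ true) (words d s)))
  else + 0
tupleSeries p a s n (suc k) m = + 0

M : {d : ℕ} → (Fin d → ℕ) → ℕ → Series
M = tupleSeries inP

N : {d : ℕ} → (Fin d → ℕ) → ℕ → Series
N = tupleSeries inQ

numerator : {d : ℕ} → (Fin d → ℕ) → Series
numerator a = oneₛ +ₛ Σₛ (λ j → M a (2 ℕ.* suc j) *ₛ (oneMinusY ^ₛ suc j))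

oddSum : (ℕ → Series) → Series
oddSum F = Σₛ (λ j → F (suc (2 ℕ.* j)) *ₛ (oneMinusY ^ₛ j))

denPeak : {d : ℕ} → (Fin d → ℕ) → Series
denPeak a = numerator a -ₛ oddSum (M a)

denValley : {d : ℕ} → (Fin d → ℕ) → Series
denValley a = numerator a -ₛ oddSum (N a)

-- Put X i = x^(aᵢ), u = y − 1 and w = 1 − y, and let C be the generating function of the
-- compositions.  Writing y^#occurrences as the product over positions of 1 + u·[occurrence] and
-- splitting off the first letter gives C = 1 + K C, where K = Σⱼ uʲ Uⱼ z^(2j+1) and Uⱼ is the
-- X-weighted sum over the zigzag words i₀ < i₁ > i₂ < ⋯ > i₂ⱼ (for valleys i₀ > i₁ < ⋯ < i₂ⱼ):
-- occurrences that share a letter chain up into such words.  For the numerator Num, Num · K is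
-- the odd sum Σⱼ wʲ M^(2j+1) (resp. N^(2j+1)): the weak steps ≤ of Pˢ are written as 1 − (>),
-- and the resulting inclusion–exclusion telescopes.  Hence C (Num − Num K) = Num (C − K C) = Num.

module Submission where

open import Defs
open import Data.Nat using (ℕ; _<_)
open import Data.Fin using (Fin) renaming (_<_ to _<ᶠ_)
open import Data.Product using (_×_; _,_)

open import Algebra.Bundles using (CommutativeRing)
import Algebra.Construct.Pointwise as Pointwise
import Algebra.Solver.CommutativeMonoid
open import Data.Bool using (Bool; true; false; not; _∧_; if_then_else_) renaming (_≟_ to _≟ᵇ_)
open import Data.Empty using (⊥-elim)
import Data.Fin as Fin
import Data.Fin.Properties as FinP
open import Data.Fin.Properties using () renaming (_<?_ to _<ᶠ?_; _≤?_ to _≤ᶠ?_)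
open import Data.List as List using (List; []; _∷_; _++_)
import Data.List.Properties as ListP
open import Data.Nat as ℕ using (zero; suc; _∸_; _≤_; z≤n; s≤s; _≟_)
import Data.Nat.Properties as ℕP
open import Function using (_∘_; id)
open import Function.Bundles using (mk⇔)
open import Relation.Binary.Definitions using (tri<; tri≈; tri>)
open import Relation.Binary.PropositionalEquality as ≡ using (_≡_; _≢_)
import Relation.Binary.Reasoning.Setoid as ≈-Reasoning
open import Relation.Nullary using (Dec; does; yes; no)
open import Relation.Nullary.Decidable using (dec-false; does-⇔; ¬?; _×-dec_)

module RangeSum {c ℓ} (R : CommutativeRing c ℓ) where
  open CommutativeRing R hiding (zero)
  open ≈-Reasoning setoid
  open import Algebra.Properties.CommutativeSemigroup +-commutativeSemigroup using (interchange)

  sum≤ : ℕ → (ℕ → Carrier) → Carrier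
  sum≤ zero    f = f 0
  sum≤ (suc n) f = f 0 + sum≤ n (f ∘ suc)

  sum≤-cong-≤ : ∀ n {f g : ℕ → Carrier} → (∀ i → i ≤ n → f i ≈ g i) → sum≤ n f ≈ sum≤ n g
  sum≤-cong-≤ zero    f≈g = f≈g 0 z≤n
  sum≤-cong-≤ (suc n) f≈g = +-cong (f≈g 0 z≤n) (sum≤-cong-≤ n (λ i i≤n → f≈g (suc i) (s≤s i≤n)))

  sum≤-cong : ∀ n {f g : ℕ → Carrier} → (∀ i → f i ≈ g i) → sum≤ n f ≈ sum≤ n g
  sum≤-cong n f≈g = sum≤-cong-≤ n (λ i _ → f≈g i)

  sum≤-zero : ∀ n {f : ℕ → Carrier} → (∀ i → i ≤ n → f i ≈ 0#) → sum≤ n f ≈ 0#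
  sum≤-zero zero    f≈0 = f≈0 0 z≤n
  sum≤-zero (suc n) f≈0 =
    trans (+-cong (f≈0 0 z≤n) (sum≤-zero n (λ i i≤n → f≈0 (suc i) (s≤s i≤n)))) (+-identityˡ 0#)

  sum≤-distrib-+ : ∀ n (f g : ℕ → Carrier) → sum≤ n (λ i → f i + g i) ≈ sum≤ n f + sum≤ n g
  sum≤-distrib-+ zero    f g = refl
  sum≤-distrib-+ (suc n) f g = trans (+-cong refl (sum≤-distrib-+ n _ _)) (interchange (f 0) (g 0) _ _)

  *-distribˡ-sum≤ : ∀ n a (f : ℕ → Carrier) → a * sum≤ n f ≈ sum≤ n (λ i → a * f i)
  *-distribˡ-sum≤ zero    a f = refl
  *-distribˡ-sum≤ (suc n) a f = trans (distribˡ a _ _) (+-cong refl (*-distribˡ-sum≤ n a _))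

  *-distribʳ-sum≤ : ∀ n a (f : ℕ → Carrier) → sum≤ n f * a ≈ sum≤ n (λ i → f i * a)
  *-distribʳ-sum≤ zero    a f = refl
  *-distribʳ-sum≤ (suc n) a f = trans (distribʳ a _ _) (+-cong refl (*-distribʳ-sum≤ n a _))

  sum≤-last : ∀ n (f : ℕ → Carrier) → sum≤ (suc n) f ≈ sum≤ n f + f (suc n)
  sum≤-last zero    f = refl
  sum≤-last (suc n) f = trans (+-cong refl (sum≤-last n _)) (sym (+-assoc _ _ _))

  sum≤-comm : ∀ m n (F : ℕ → ℕ → Carrier) →
              sum≤ m (λ i → sum≤ n (F i)) ≈ sum≤ n (λ j → sum≤ m (λ i → F i j))
  sum≤-comm zero    n F = refl
  sum≤-comm (suc m) n F = trans (+-cong refl (sum≤-comm m n _)) (sym (sum≤-distrib-+ n _ _))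

  sum≤-reverse : ∀ n (f : ℕ → Carrier) → sum≤ n f ≈ sum≤ n (λ i → f (n ∸ i))
  sum≤-reverse zero    f = refl
  sum≤-reverse (suc n) f = begin
    f 0 + sum≤ n (f ∘ suc)                           ≈⟨ +-comm _ _ ⟩
    sum≤ n (f ∘ suc) + f 0                           ≈⟨ +-cong (sum≤-reverse n _) refl ⟩
    sum≤ n (λ i → f (suc (n ∸ i))) + f 0             ≈⟨ +-cong (sum≤-cong-≤ n shift) last ⟩
    sum≤ n (λ i → f (suc n ∸ i)) + f (suc n ∸ suc n) ≈⟨ sym (sum≤-last n _) ⟩
    sum≤ (suc n) (λ i → f (suc n ∸ i))               ∎
    where
    shift : ∀ i → i ≤ n → f (suc (n ∸ i)) ≈ f (suc n ∸ i)
    shift i i≤n = reflexive (≡.cong f (≡.sym (ℕP.+-∸-assoc 1 i≤n)))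
    last : f 0 ≈ f (n ∸ n)
    last = reflexive (≡.cong f (≡.sym (ℕP.n∸n≡0 n)))

  sum≤-triangle : ∀ n (F : ℕ → ℕ → Carrier) →
                  sum≤ n (λ l → sum≤ l (F l)) ≈ sum≤ n (λ i → sum≤ (n ∸ i) (λ j → F (i ℕ.+ j) i))
  sum≤-triangle zero    F = refl
  sum≤-triangle (suc n) F = begin
    sum≤ (suc n) (λ l → sum≤ l (F l))
      ≈⟨ sum≤-last n _ ⟩
    sum≤ n (λ l → sum≤ l (F l)) + sum≤ (suc n) (F (suc n))
      ≈⟨ +-cong (sum≤-triangle n F) (sum≤-last n _) ⟩
    sum≤ n column + (sum≤ n (F (suc n)) + F (suc n) (suc n))
      ≈⟨ sym (+-assoc _ _ _) ⟩
    (sum≤ n column + sum≤ n (F (suc n))) + F (suc n) (suc n)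
      ≈⟨ +-cong (sym (sum≤-distrib-+ n _ _)) corner ⟩
    sum≤ n (λ i → column i + F (suc n) i) + sum≤ (suc n ∸ suc n) (λ j → F (suc n ℕ.+ j) (suc n))
      ≈⟨ +-cong (sum≤-cong-≤ n extend) refl ⟩
    sum≤ n (λ i → sum≤ (suc n ∸ i) (λ j → F (i ℕ.+ j) i)) + sum≤ (suc n ∸ suc n) (λ j → F (suc n ℕ.+ j) (suc n))
      ≈⟨ sym (sum≤-last n _) ⟩
    sum≤ (suc n) (λ i → sum≤ (suc n ∸ i) (λ j → F (i ℕ.+ j) i))
      ∎
    where
    column : ℕ → Carrier
    column i = sum≤ (n ∸ i) (λ j → F (i ℕ.+ j) i)

    corner : F (suc n) (suc n) ≈ sum≤ (suc n ∸ suc n) (λ j → F (suc n ℕ.+ j) (suc n))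
    corner rewrite ℕP.n∸n≡0 n | ℕP.+-identityʳ n = refl

    extend : ∀ i → i ≤ n → column i + F (suc n) i ≈ sum≤ (suc n ∸ i) (λ j → F (i ℕ.+ j) i)
    extend i i≤n = begin
      column i + F (suc n) i
        ≈⟨ +-cong refl (reflexive (≡.cong (λ k → F k i) (≡.sym i+[1+n∸i]≡1+n))) ⟩
      column i + F (i ℕ.+ suc (n ∸ i)) i
        ≈⟨ sym (sum≤-last (n ∸ i) _) ⟩
      sum≤ (suc (n ∸ i)) (λ j → F (i ℕ.+ j) i)
        ≈⟨ reflexive (≡.cong (λ k → sum≤ k (λ j → F (i ℕ.+ j) i)) 1+[n∸i]≡1+n∸i) ⟩
      sum≤ (suc n ∸ i) (λ j → F (i ℕ.+ j) i)
        ∎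
      where
      1+[n∸i]≡1+n∸i : suc (n ∸ i) ≡ suc n ∸ i
      1+[n∸i]≡1+n∸i = ≡.sym (ℕP.+-∸-assoc 1 i≤n)
      i+[1+n∸i]≡1+n : i ℕ.+ suc (n ∸ i) ≡ suc n
      i+[1+n∸i]≡1+n = ≡.trans (ℕP.+-suc i (n ∸ i)) (≡.cong suc (ℕP.m+[n∸m]≡n i≤n))

module PowerSeries {c ℓ} (R : CommutativeRing c ℓ) where
  open CommutativeRing R hiding (zero)
  open ≈-Reasoning setoid
  open RangeSum R

  Seq : Set c
  Seq = ℕ → Carrier

  infix  4 _≋_
  infixl 6 _⊕_
  infixl 7 _⊛_

  _≋_ : Seq → Seq → Set ℓ
  f ≋ g = ∀ n → f n ≈ g n

  _⊕_ : Seq → Seq → Seq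
  (f ⊕ g) n = f n + g n

  ⊖_ : Seq → Seq
  (⊖ f) n = - f n

  𝟘 : Seq
  𝟘 _ = 0#

  𝟙 : Seq
  𝟙 zero    = 1#
  𝟙 (suc _) = 0#

  _⊛_ : Seq → Seq → Seq
  (f ⊛ g) n = sum≤ n (λ i → f i * g (n ∸ i))

  ⊛-cong : ∀ {f f′ g g′} → f ≋ f′ → g ≋ g′ → f ⊛ g ≋ f′ ⊛ g′
  ⊛-cong f≋f′ g≋g′ n = sum≤-cong n (λ i → *-cong (f≋f′ i) (g≋g′ (n ∸ i)))

  ⊛-comm : ∀ f g → f ⊛ g ≋ g ⊛ f
  ⊛-comm f g n = begin
    sum≤ n (λ i → f i * g (n ∸ i))             ≈⟨ sum≤-reverse n _ ⟩
    sum≤ n (λ i → f (n ∸ i) * g (n ∸ (n ∸ i))) ≈⟨ sum≤-cong-≤ n swap ⟩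
    sum≤ n (λ i → g i * f (n ∸ i))             ∎
    where
    swap : ∀ i → i ≤ n → f (n ∸ i) * g (n ∸ (n ∸ i)) ≈ g i * f (n ∸ i)
    swap i i≤n = trans (*-cong refl (reflexive (≡.cong g (ℕP.m∸[m∸n]≡n i≤n)))) (*-comm _ _)

  ⊛-assoc : ∀ f g h → (f ⊛ g) ⊛ h ≋ f ⊛ (g ⊛ h)
  ⊛-assoc f g h n = begin
    sum≤ n (λ l → sum≤ l (λ i → f i * g (l ∸ i)) * h (n ∸ l))
      ≈⟨ sum≤-cong n (λ l → *-distribʳ-sum≤ l _ _) ⟩
    sum≤ n (λ l → sum≤ l (λ i → (f i * g (l ∸ i)) * h (n ∸ l)))
      ≈⟨ sum≤-triangle n _ ⟩
    sum≤ n (λ i → sum≤ (n ∸ i) (λ j → (f i * g ((i ℕ.+ j) ∸ i)) * h (n ∸ (i ℕ.+ j))))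
      ≈⟨ sum≤-cong n (λ i → sum≤-cong (n ∸ i) (λ j → trans (*-assoc _ _ _) (*-cong refl (reindex i j)))) ⟩
    sum≤ n (λ i → sum≤ (n ∸ i) (λ j → f i * (g j * h ((n ∸ i) ∸ j))))
      ≈⟨ sum≤-cong n (λ i → sym (*-distribˡ-sum≤ (n ∸ i) _ _)) ⟩
    sum≤ n (λ i → f i * sum≤ (n ∸ i) (λ j → g j * h ((n ∸ i) ∸ j)))
      ∎
    where
    reindex : ∀ i j → g ((i ℕ.+ j) ∸ i) * h (n ∸ (i ℕ.+ j)) ≈ g j * h ((n ∸ i) ∸ j)
    reindex i j = *-cong (reflexive (≡.cong g (ℕP.m+n∸m≡n i j)))
                         (reflexive (≡.cong h (≡.sym (ℕP.∸-+-assoc n i j))))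

  ⊛-distribˡ : ∀ f g h → f ⊛ (g ⊕ h) ≋ f ⊛ g ⊕ f ⊛ h
  ⊛-distribˡ f g h n = trans (sum≤-cong n (λ i → distribˡ _ _ _)) (sum≤-distrib-+ n _ _)

  ⊛-distribʳ : ∀ f g h → (g ⊕ h) ⊛ f ≋ g ⊛ f ⊕ h ⊛ f
  ⊛-distribʳ f g h n = trans (sum≤-cong n (λ i → distribʳ _ _ _)) (sum≤-distrib-+ n _ _)

  ⊛-identityˡ : ∀ f → 𝟙 ⊛ f ≋ f
  ⊛-identityˡ f zero    = *-identityˡ _
  ⊛-identityˡ f (suc n) =
    trans (+-cong (*-identityˡ _) (sum≤-zero n (λ i _ → zeroˡ _))) (+-identityʳ _)

  ⊛-identityʳ : ∀ f → f ⊛ 𝟙 ≋ f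
  ⊛-identityʳ f n = trans (⊛-comm f 𝟙 n) (⊛-identityˡ f n)

  powerSeriesRing : CommutativeRing c ℓ
  powerSeriesRing = record
    { _≈_ = _≋_
    ; _+_ = _⊕_
    ; _*_ = _⊛_
    ; -_  = ⊖_
    ; 0#  = 𝟘
    ; 1#  = 𝟙
    ; isCommutativeRing = record
      { isRing = record
        { +-isAbelianGroup = Pointwise.isAbelianGroup ℕ +-isAbelianGroup
        ; *-cong     = ⊛-cong
        ; *-assoc    = ⊛-assoc
        ; *-identity = ⊛-identityˡ , ⊛-identityʳ
        ; distrib    = ⊛-distribˡ , ⊛-distribʳ
        }
      ; *-comm = ⊛-comm
      }
    }

  sum≤-coefficient : ∀ m (F : ℕ → Seq) n → RangeSum.sum≤ powerSeriesRing m F n ≈ sum≤ m (λ i → F i n)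
  sum≤-coefficient zero    F n = refl
  sum≤-coefficient (suc m) F n = +-cong refl (sum≤-coefficient m (F ∘ suc) n)

  onlyIf : Bool → Carrier → Carrier
  onlyIf b x = if b then x else 0#

  onlyIf-cong : ∀ b {x y} → x ≈ y → onlyIf b x ≈ onlyIf b y
  onlyIf-cong true  x≈y = x≈y
  onlyIf-cong false x≈y = refl

  onlyIf-false : ∀ {b} x → b ≡ false → onlyIf b x ≈ 0#
  onlyIf-false x ≡.refl = refl

  onlyIf-*ʳ : ∀ b x y → onlyIf b x * y ≈ onlyIf b (x * y)
  onlyIf-*ʳ true  x y = refl
  onlyIf-*ʳ false x y = zeroˡ y

  onlyIf-*ˡ : ∀ b x y → y * onlyIf b x ≈ onlyIf b (y * x)
  onlyIf-*ˡ true  x y = refl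
  onlyIf-*ˡ false x y = zeroʳ y

  sum≤-select : ∀ n p (f : ℕ → Carrier) → p ≤ n → sum≤ n (λ i → onlyIf (does (p ≟ i)) (f i)) ≈ f p
  sum≤-select zero    zero    f z≤n       = refl
  sum≤-select (suc n) zero    f z≤n       = trans (+-cong refl (sum≤-zero n (λ _ _ → refl))) (+-identityʳ _)
  sum≤-select (suc n) (suc p) f (s≤s p≤n) = trans (+-identityˡ _) (sum≤-select n p (f ∘ suc) p≤n)

  sum≤-select-none : ∀ n p (f : ℕ → Carrier) → n < p → sum≤ n (λ i → onlyIf (does (p ≟ i)) (f i)) ≈ 0#
  sum≤-select-none zero    (suc p) f n<p       = refl
  sum≤-select-none (suc n) (suc p) f (s≤s n<p) = trans (+-identityˡ _) (sum≤-select-none n p (f ∘ suc) n<p)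

  monomial : Carrier → ℕ → Seq
  monomial x p n = onlyIf (does (p ≟ n)) x

  monomial-cong : ∀ {x x′} p → x ≈ x′ → monomial x p ≋ monomial x′ p
  monomial-cong p x≈x′ n = onlyIf-cong (does (p ≟ n)) x≈x′

  monomial-⊛ : ∀ x p x′ p′ → monomial x p ⊛ monomial x′ p′ ≋ monomial (x * x′) (p ℕ.+ p′)
  monomial-⊛ x p x′ p′ n = trans (sum≤-cong n (λ i → onlyIf-*ʳ (does (p ≟ i)) x _)) (by-cases (p ℕ.≤? n))
    where
    by-cases : Dec (p ≤ n) →
               sum≤ n (λ i → onlyIf (does (p ≟ i)) (x * monomial x′ p′ (n ∸ i))) ≈ monomial (x * x′) (p ℕ.+ p′) n
    by-cases (yes p≤n) = begin
      sum≤ n (λ i → onlyIf (does (p ≟ i)) (x * monomial x′ p′ (n ∸ i)))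
        ≈⟨ sum≤-select n p _ p≤n ⟩
      x * onlyIf (does (p′ ≟ n ∸ p)) x′
        ≈⟨ onlyIf-*ˡ (does (p′ ≟ n ∸ p)) x′ x ⟩
      onlyIf (does (p′ ≟ n ∸ p)) (x * x′)
        ≈⟨ reflexive (≡.cong (λ b → onlyIf b (x * x′)) same-test) ⟩
      onlyIf (does (p ℕ.+ p′ ≟ n)) (x * x′)
        ∎
      where
      same-test : does (p′ ≟ n ∸ p) ≡ does (p ℕ.+ p′ ≟ n)
      same-test = does-⇔ (mk⇔ (λ eq → ≡.trans (≡.cong (p ℕ.+_) eq) (ℕP.m+[n∸m]≡n p≤n))
                              (λ eq → ≡.trans (≡.sym (ℕP.m+n∸m≡n p p′)) (≡.cong (_∸ p) eq)))
                         (p′ ≟ n ∸ p) (p ℕ.+ p′ ≟ n)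
    by-cases (no p≰n) = begin
      sum≤ n (λ i → onlyIf (does (p ≟ i)) (x * monomial x′ p′ (n ∸ i)))
        ≈⟨ sum≤-select-none n p _ (ℕP.≰⇒> p≰n) ⟩
      0#
        ≈⟨ sym (onlyIf-false (x * x′) (dec-false (p ℕ.+ p′ ≟ n) p+p′≢n)) ⟩
      onlyIf (does (p ℕ.+ p′ ≟ n)) (x * x′)
        ∎
      where
      p+p′≢n : p ℕ.+ p′ ≢ n
      p+p′≢n eq = p≰n (≡.subst (p ≤_) eq (ℕP.m≤m+n p p′))

  constant : Carrier → Seq
  constant x = monomial x 0

  constant-⊛ : ∀ x f → constant x ⊛ f ≋ (λ m → x * f m)
  constant-⊛ x f zero    = refl
  constant-⊛ x f (suc m) = trans (+-cong refl (sum≤-zero m (λ _ _ → zeroˡ _))) (+-identityʳ _)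

  ⊛-constant : ∀ f x → f ⊛ constant x ≋ (λ m → f m * x)
  ⊛-constant f x m = trans (⊛-comm f (constant x) m) (trans (constant-⊛ x f m) (*-comm _ _))

  atOdd : (ℕ → Carrier) → Seq
  atOdd g zero          = 0#
  atOdd g (suc zero)    = g 0
  atOdd g (suc (suc n)) = atOdd (g ∘ suc) n

  atEven : (ℕ → Carrier) → Seq
  atEven g zero    = g 0
  atEven g (suc n) = atOdd (g ∘ suc) n

  atOdd-cong : ∀ {g h : ℕ → Carrier} → (∀ i → g i ≈ h i) → atOdd g ≋ atOdd h
  atOdd-cong g≈h zero          = refl
  atOdd-cong g≈h (suc zero)    = g≈h 0
  atOdd-cong g≈h (suc (suc n)) = atOdd-cong (g≈h ∘ suc) n

  atOdd-+ : ∀ (g h : ℕ → Carrier) → atOdd (λ i → g i + h i) ≋ atOdd g ⊕ atOdd h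
  atOdd-+ g h zero          = sym (+-identityˡ 0#)
  atOdd-+ g h (suc zero)    = refl
  atOdd-+ g h (suc (suc n)) = atOdd-+ (g ∘ suc) (h ∘ suc) n

  atOdd-*ʳ : ∀ (g : ℕ → Carrier) x n → atOdd (λ i → g i * x) n ≈ atOdd g n * x
  atOdd-*ʳ g x zero          = sym (zeroˡ x)
  atOdd-*ʳ g x (suc zero)    = refl
  atOdd-*ʳ g x (suc (suc n)) = atOdd-*ʳ (g ∘ suc) x n

  atEven-⊛-atOdd : ∀ (g h : ℕ → Carrier) →
                   atEven g ⊛ atOdd h ≋ atOdd (λ J → sum≤ J (λ j → g j * h (J ∸ j)))
  atEven-⊛-atOdd g h zero          = zeroʳ _
  atEven-⊛-atOdd g h (suc zero)    = trans (+-cong refl (zeroˡ _)) (+-identityʳ _)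
  atEven-⊛-atOdd g h (suc (suc m)) = begin
    sum≤ (suc (suc m)) term
      ≈⟨ sum≤-last (suc m) term ⟩
    sum≤ (suc m) term + atEven g (suc (suc m)) * atOdd h (m ∸ m)
      ≈⟨ +-cong (sum≤-last m term) (trans (*-cong refl (reflexive (≡.cong (atOdd h) (ℕP.n∸n≡0 m)))) (zeroʳ _)) ⟩
    (sum≤ m term + term (suc m)) + 0#
      ≈⟨ +-identityʳ _ ⟩
    sum≤ m term + atOdd (g ∘ suc) m * atOdd h (suc (suc m) ∸ suc m)
      ≈⟨ +-cong (sum≤-cong-≤ m (λ i i≤m → *-cong refl (reflexive (≡.cong (atOdd h) (ℕP.+-∸-assoc 2 i≤m))))) last ⟩
    (atEven g ⊛ atOdd (h ∘ suc)) m + atOdd (λ J → g (suc J) * h 0) m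
      ≈⟨ +-cong (atEven-⊛-atOdd g (h ∘ suc) m) refl ⟩
    atOdd (λ J → sum≤ J (λ j → g j * h (suc (J ∸ j)))) m + atOdd (λ J → g (suc J) * h 0) m
      ≈⟨ sym (atOdd-+ _ _ m) ⟩
    atOdd (λ J → sum≤ J (λ j → g j * h (suc (J ∸ j))) + g (suc J) * h 0) m
      ≈⟨ atOdd-cong peel m ⟩
    atOdd (λ J → sum≤ (suc J) (λ j → g j * h (suc J ∸ j))) m
      ∎
    where
    term : ℕ → Carrier
    term i = atEven g i * atOdd h (suc (suc m) ∸ i)

    last : atOdd (g ∘ suc) m * atOdd h (suc m ∸ m) ≈ atOdd (λ J → g (suc J) * h 0) m
    last = trans (*-cong refl (reflexive (≡.cong (atOdd h) (ℕP.m+n∸n≡m 1 m)))) (sym (atOdd-*ʳ _ (h 0) m))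

    peel : ∀ J → sum≤ J (λ j → g j * h (suc (J ∸ j))) + g (suc J) * h 0 ≈ sum≤ (suc J) (λ j → g j * h (suc J ∸ j))
    peel J = sym (trans (sum≤-last J _)
                        (+-cong (sum≤-cong-≤ J (λ j j≤J → *-cong refl (reflexive (≡.cong h (ℕP.+-∸-assoc 1 j≤J)))))
                                (*-cong refl (reflexive (≡.cong h (ℕP.n∸n≡0 J))))))

  sum≤-onlyIf-odd : ∀ (h : ℕ → Carrier) m → sum≤ m (λ j → onlyIf (does (m ≟ suc (2 ℕ.* j))) (h j)) ≈ atOdd h m
  sum≤-onlyIf-odd h zero          = refl
  sum≤-onlyIf-odd h (suc zero)    = +-identityʳ _
  sum≤-onlyIf-odd h (suc (suc m)) = begin
    sum≤ (suc (suc m)) (λ j → onlyIf (does (suc (suc m) ≟ suc (2 ℕ.* j))) (h j))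
      ≈⟨ +-identityˡ _ ⟩
    sum≤ (suc m) (λ j → onlyIf (does (suc (suc m) ≟ suc (2 ℕ.* suc j))) (h (suc j)))
      ≈⟨ sum≤-cong (suc m) (λ j → reflexive (≡.cong (λ k → onlyIf (does (suc (suc m) ≟ suc k)) (h (suc j)))
                                                    (ℕP.*-suc 2 j))) ⟩
    sum≤ (suc m) (λ j → onlyIf (does (m ≟ suc (2 ℕ.* j))) (h (suc j)))
      ≈⟨ sum≤-last m _ ⟩
    sum≤ m (λ j → onlyIf (does (m ≟ suc (2 ℕ.* j))) (h (suc j)))
      + onlyIf (does (m ≟ suc (2 ℕ.* suc m))) (h (suc (suc m)))
      ≈⟨ +-cong (sum≤-onlyIf-odd (h ∘ suc) m) (onlyIf-false _ (dec-false (m ≟ _) m≢1+2[1+m])) ⟩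
    atOdd (h ∘ suc) m + 0#
      ≈⟨ +-identityʳ _ ⟩
    atOdd h (suc (suc m))
      ∎
    where
    m≢1+2[1+m] : m ≢ suc (2 ℕ.* suc m)
    m≢1+2[1+m] eq = ℕP.<-irrefl eq (s≤s (ℕP.≤-trans (ℕP.n≤1+n m) (ℕP.m≤m+n (suc m) (suc m ℕ.+ 0))))

  𝟙+sum≤-onlyIf-even : ∀ (h : ℕ → Carrier) → h 0 ≈ 1# → ∀ m →
                        𝟙 m + sum≤ m (λ j → onlyIf (does (m ≟ 2 ℕ.* suc j)) (h (suc j))) ≈ atEven h m
  𝟙+sum≤-onlyIf-even h h0≈1 zero    = trans (+-identityʳ 1#) (sym h0≈1)
  𝟙+sum≤-onlyIf-even h h0≈1 (suc m) = begin
    0# + sum≤ (suc m) (λ j → onlyIf (does (suc m ≟ 2 ℕ.* suc j)) (h (suc j)))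
      ≈⟨ +-identityˡ _ ⟩
    sum≤ (suc m) (λ j → onlyIf (does (suc m ≟ 2 ℕ.* suc j)) (h (suc j)))
      ≈⟨ sum≤-last m _ ⟩
    sum≤ m (λ j → onlyIf (does (suc m ≟ 2 ℕ.* suc j)) (h (suc j)))
      + onlyIf (does (suc m ≟ 2 ℕ.* suc (suc m))) (h (suc (suc m)))
      ≈⟨ +-cong (sum≤-cong m (λ j → reflexive (≡.cong (λ k → onlyIf (does (suc m ≟ k)) (h (suc j))) (ℕP.*-suc 2 j))))
                (onlyIf-false _ (dec-false (suc m ≟ _) 1+m≢2[2+m])) ⟩
    sum≤ m (λ j → onlyIf (does (m ≟ suc (2 ℕ.* j))) (h (suc j))) + 0#
      ≈⟨ +-identityʳ _ ⟩
    sum≤ m (λ j → onlyIf (does (m ≟ suc (2 ℕ.* j))) (h (suc j)))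
      ≈⟨ sum≤-onlyIf-odd (h ∘ suc) m ⟩
    atEven h (suc m)
      ∎
    where
    1+m≢2[2+m] : suc m ≢ 2 ℕ.* suc (suc m)
    1+m≢2[2+m] eq = ℕP.<-irrefl eq (s≤s (s≤s (ℕP.m≤m+n m _)))

module FiniteSums {c ℓ} (R : CommutativeRing c ℓ) where
  open CommutativeRing R hiding (zero)
  open ≈-Reasoning setoid
  open import Algebra.Properties.Semiring.Sum semiring public
  open import Algebra.Properties.Ring ring using (-1*x≈-x)

  -‿distrib-sum : ∀ {n} (f : Fin n → Carrier) → - sum f ≈ ∑[ i < n ] (- f i)
  -‿distrib-sum f = begin
    - sum f                  ≈⟨ sym (-1*x≈-x _) ⟩
    - 1# * sum f             ≈⟨ *-distribˡ-sum (- 1#) f ⟩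
    ∑[ i < _ ] (- 1# * f i)  ≈⟨ sum-cong-≋ (λ i → -1*x≈-x (f i)) ⟩
    ∑[ i < _ ] (- f i)       ∎

  iverson : Bool → Carrier
  iverson true  = 1#
  iverson false = 0#

  iverson-∧ : ∀ a b → iverson (a ∧ b) ≈ iverson a * iverson b
  iverson-∧ true  b = sym (*-identityˡ _)
  iverson-∧ false b = sym (zeroˡ _)

  iverson-not : ∀ b → iverson (not b) ≈ 1# - iverson b
  iverson-not true  = sym (-‿inverseʳ 1#)
  iverson-not false = sym (trans (+-cong refl ε⁻¹≈ε) (+-identityʳ 1#))
    where open import Algebra.Properties.Group +-group using (ε⁻¹≈ε)

  module _ {A : Set} where

    sumOver : List A → (A → Carrier) → Carrier
    sumOver []       f = 0#
    sumOver (x ∷ xs) f = f x + sumOver xs f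

    sumOver-cong : ∀ xs {f g : A → Carrier} → (∀ x → f x ≈ g x) → sumOver xs f ≈ sumOver xs g
    sumOver-cong []       f≈g = refl
    sumOver-cong (x ∷ xs) f≈g = +-cong (f≈g x) (sumOver-cong xs f≈g)

    sumOver-zero : ∀ xs {f : A → Carrier} → (∀ x → f x ≈ 0#) → sumOver xs f ≈ 0#
    sumOver-zero []       f≈0 = refl
    sumOver-zero (x ∷ xs) f≈0 = trans (+-cong (f≈0 x) (sumOver-zero xs f≈0)) (+-identityˡ _)

    sumOver-distrib-+ : ∀ xs (f g : A → Carrier) → sumOver xs (λ x → f x + g x) ≈ sumOver xs f + sumOver xs g
    sumOver-distrib-+ []       f g = sym (+-identityˡ _)
    sumOver-distrib-+ (x ∷ xs) f g = trans (+-cong refl (sumOver-distrib-+ xs f g)) (interchange _ _ _ _)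
      where open import Algebra.Properties.CommutativeSemigroup +-commutativeSemigroup using (interchange)

    *-distribˡ-sumOver : ∀ xs a (f : A → Carrier) → a * sumOver xs f ≈ sumOver xs (λ x → a * f x)
    *-distribˡ-sumOver []       a f = zeroʳ a
    *-distribˡ-sumOver (x ∷ xs) a f = trans (distribˡ _ _ _) (+-cong refl (*-distribˡ-sumOver xs a f))

    sumOver-++ : ∀ xs ys (f : A → Carrier) → sumOver (xs ++ ys) f ≈ sumOver xs f + sumOver ys f
    sumOver-++ []       ys f = sym (+-identityˡ _)
    sumOver-++ (x ∷ xs) ys f = trans (+-cong refl (sumOver-++ xs ys f)) (sym (+-assoc _ _ _))

    sum-sumOver-comm : ∀ {n} xs (F : Fin n → A → Carrier) →
                       ∑[ i < n ] sumOver xs (F i) ≈ sumOver xs (λ x → ∑[ i < n ] F i x)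
    sum-sumOver-comm {zero}  xs F = sym (sumOver-zero xs (λ _ → refl))
    sum-sumOver-comm {suc n} xs F =
      trans (+-cong refl (sum-sumOver-comm xs (F ∘ Fin.suc))) (sym (sumOver-distrib-+ xs _ _))

  sumOver-map : ∀ {A B : Set} (g : A → B) xs (f : B → Carrier) → sumOver (List.map g xs) f ≈ sumOver xs (f ∘ g)
  sumOver-map g []       f = refl
  sumOver-map g (x ∷ xs) f = +-cong refl (sumOver-map g xs f)

  sumOver-concatMap : ∀ {A B : Set} (g : A → List B) xs (f : B → Carrier) →
                      sumOver (List.concatMap g xs) f ≈ sumOver xs (λ x → sumOver (g x) f)
  sumOver-concatMap g []       f = refl
  sumOver-concatMap g (x ∷ xs) f = trans (sumOver-++ (g x) _ f) (+-cong refl (sumOver-concatMap g xs f))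

  sumOver-tabulate : ∀ {n} {A : Set} (g : Fin n → A) (f : A → Carrier) → sumOver (List.tabulate g) f ≈ sum (f ∘ g)
  sumOver-tabulate {zero}  g f = refl
  sumOver-tabulate {suc n} g f = +-cong refl (sumOver-tabulate (g ∘ Fin.suc) f)

  wordSum : ∀ d → ℕ → (List (Fin d) → Carrier) → Carrier
  wordSum d m = sumOver (words d m)

  wordSum-suc : ∀ d m f → wordSum d (suc m) f ≈ ∑[ i < d ] wordSum d m (λ τ → f (i ∷ τ))
  wordSum-suc d m f = begin
    sumOver (words d (suc m)) f
      ≈⟨ sumOver-concatMap (λ w → List.map (_∷ w) (List.allFin d)) (words d m) f ⟩
    sumOver (words d m) (λ w → sumOver (List.map (_∷ w) (List.allFin d)) f)
      ≈⟨ sumOver-cong (words d m) (λ w → trans (sumOver-map (_∷ w) (List.allFin d) f) (sumOver-tabulate {d} id _)) ⟩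
    sumOver (words d m) (λ w → ∑[ i < d ] f (i ∷ w))
      ≈⟨ sym (sum-sumOver-comm {n = d} (words d m) (λ i τ → f (i ∷ τ))) ⟩
    ∑[ i < d ] wordSum d m (λ τ → f (i ∷ τ))
      ∎

module ChainSums {c ℓ} (R : CommutativeRing c ℓ) {d : ℕ} (X : Fin d → CommutativeRing.Carrier R) where
  open CommutativeRing R hiding (zero)
  open ≈-Reasoning setoid
  open FiniteSums R
  open import Algebra.Properties.CommutativeSemigroup *-commutativeSemigroup using (x∙yz≈y∙xz)
  open import Algebra.Properties.Ring ring using (-1*x≈-x)

  ∑-cong : {f g : Fin d → Carrier} → (∀ i → f i ≈ g i) → sum f ≈ sum g
  ∑-cong = sum-cong-≋

  Matrix : Set c
  Matrix = Fin d → Fin d → Carrier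

  -- pathSum [r₁,…,rₖ] i v = Σ_{j₁…jₖ} X i · r₁ i j₁ · X j₁ ⋯ X jₖ₋₁ · rₖ jₖ₋₁ jₖ · v jₖ, so for
  -- 0/1 matrices chainSum [r₁,…,rₖ] is the X-weighted sum over the words j₀ … jₖ with rₜ jₜ₋₁ jₜ.
  pathSum : List Matrix → Fin d → (Fin d → Carrier) → Carrier
  pathSum []       i v = v i
  pathSum (r ∷ rs) i v = X i * ∑[ j < d ] (r i j * pathSum rs j v)

  chainSum : List Matrix → Carrier
  chainSum rs = ∑[ i < d ] pathSum rs i X

  pathSum-cong : ∀ rs i {v w : Fin d → Carrier} → (∀ e → v e ≈ w e) → pathSum rs i v ≈ pathSum rs i w
  pathSum-cong []       i v≈w = v≈w i
  pathSum-cong (r ∷ rs) i v≈w = *-cong refl (∑-cong (λ j → *-cong refl (pathSum-cong rs j v≈w)))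

  pathSum-++ : ∀ rs ss i v → pathSum (rs ++ ss) i v ≈ pathSum rs i (λ e → pathSum ss e v)
  pathSum-++ []       ss i v = refl
  pathSum-++ (r ∷ rs) ss i v = *-cong refl (∑-cong (λ j → *-cong refl (pathSum-++ rs ss j v)))

  pathSum-+ : ∀ rs i (v w : Fin d → Carrier) → pathSum rs i (λ e → v e + w e) ≈ pathSum rs i v + pathSum rs i w
  pathSum-+ []       i v w = refl
  pathSum-+ (r ∷ rs) i v w = begin
    X i * ∑[ j < d ] (r i j * pathSum rs j (λ e → v e + w e))
      ≈⟨ *-cong refl (∑-cong (λ j → trans (*-cong refl (pathSum-+ rs j v w)) (distribˡ _ _ _))) ⟩
    X i * ∑[ j < d ] (r i j * pathSum rs j v + r i j * pathSum rs j w)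
      ≈⟨ *-cong refl (∑-distrib-+ (λ j → r i j * pathSum rs j v) (λ j → r i j * pathSum rs j w)) ⟩
    X i * (∑[ j < d ] (r i j * pathSum rs j v) + ∑[ j < d ] (r i j * pathSum rs j w))
      ≈⟨ distribˡ _ _ _ ⟩
    pathSum (r ∷ rs) i v + pathSum (r ∷ rs) i w
      ∎

  pathSum-* : ∀ rs i a (v : Fin d → Carrier) → pathSum rs i (λ e → a * v e) ≈ a * pathSum rs i v
  pathSum-* []       i a v = refl
  pathSum-* (r ∷ rs) i a v = begin
    X i * ∑[ j < d ] (r i j * pathSum rs j (λ e → a * v e))
      ≈⟨ *-cong refl (∑-cong (λ j → trans (*-cong refl (pathSum-* rs j a v)) (x∙yz≈y∙xz _ _ _))) ⟩
    X i * ∑[ j < d ] (a * (r i j * pathSum rs j v))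
      ≈⟨ *-cong refl (sym (*-distribˡ-sum a (λ j → r i j * pathSum rs j v))) ⟩
    X i * (a * ∑[ j < d ] (r i j * pathSum rs j v))
      ≈⟨ x∙yz≈y∙xz _ _ _ ⟩
    a * pathSum (r ∷ rs) i v
      ∎

  pathSum-neg : ∀ rs i (v : Fin d → Carrier) → pathSum rs i (λ e → - v e) ≈ - pathSum rs i v
  pathSum-neg rs i v = begin
    pathSum rs i (λ e → - v e)       ≈⟨ pathSum-cong rs i (λ e → sym (-1*x≈-x (v e))) ⟩
    pathSum rs i (λ e → - 1# * v e)  ≈⟨ pathSum-* rs i (- 1#) v ⟩
    - 1# * pathSum rs i v            ≈⟨ -1*x≈-x _ ⟩
    - pathSum rs i v                 ∎

  chainSum-split : ∀ rs ss (r s : Matrix) → (∀ a b → r a b ≈ 1# - s a b) →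
                   chainSum (rs ++ r ∷ ss) ≈ chainSum rs * chainSum ss - chainSum (rs ++ s ∷ ss)
  chainSum-split rs ss r s r≈1-s = begin
    ∑[ i < d ] pathSum (rs ++ r ∷ ss) i X
      ≈⟨ ∑-cong (λ i → trans (pathSum-++ rs (r ∷ ss) i X) (pathSum-cong rs i link)) ⟩
    ∑[ i < d ] pathSum rs i (λ a → chainSum ss * X a + - pathSum (s ∷ ss) a X)
      ≈⟨ ∑-cong (λ i → pathSum-+ rs i _ _) ⟩
    ∑[ i < d ] (pathSum rs i (λ a → chainSum ss * X a) + pathSum rs i (λ a → - pathSum (s ∷ ss) a X))
      ≈⟨ ∑-distrib-+ (λ i → pathSum rs i (λ a → chainSum ss * X a))
                     (λ i → pathSum rs i (λ a → - pathSum (s ∷ ss) a X)) ⟩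
    ∑[ i < d ] pathSum rs i (λ a → chainSum ss * X a) + ∑[ i < d ] pathSum rs i (λ a → - pathSum (s ∷ ss) a X)
      ≈⟨ +-cong (∑-cong (λ i → pathSum-* rs i (chainSum ss) X)) (∑-cong (λ i → pathSum-neg rs i _)) ⟩
    ∑[ i < d ] (chainSum ss * pathSum rs i X) + ∑[ i < d ] (- pathSum rs i (λ a → pathSum (s ∷ ss) a X))
      ≈⟨ +-cong (trans (sym (*-distribˡ-sum (chainSum ss) (λ i → pathSum rs i X))) (*-comm _ _))
                (sym (-‿distrib-sum (λ i → pathSum rs i (λ a → pathSum (s ∷ ss) a X)))) ⟩
    chainSum rs * chainSum ss - ∑[ i < d ] pathSum rs i (λ a → pathSum (s ∷ ss) a X)
      ≈⟨ +-cong refl (-‿cong (∑-cong (λ i → sym (pathSum-++ rs (s ∷ ss) i X)))) ⟩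
    chainSum rs * chainSum ss - chainSum (rs ++ s ∷ ss)
      ∎
    where
    link : ∀ a → pathSum (r ∷ ss) a X ≈ chainSum ss * X a + - pathSum (s ∷ ss) a X
    link a = begin
      X a * ∑[ b < d ] (r a b * pathSum ss b X)
        ≈⟨ *-cong refl (∑-cong (λ b → trans (*-cong (r≈1-s a b) refl) (distribʳ _ _ _))) ⟩
      X a * ∑[ b < d ] (1# * pathSum ss b X + - s a b * pathSum ss b X)
        ≈⟨ *-cong refl (∑-distrib-+ (λ b → 1# * pathSum ss b X) (λ b → - s a b * pathSum ss b X)) ⟩
      X a * (∑[ b < d ] (1# * pathSum ss b X) + ∑[ b < d ] (- s a b * pathSum ss b X))
        ≈⟨ *-cong refl (+-cong (∑-cong (λ b → *-identityˡ _))
                                (trans (∑-cong (λ b → sym (-‿distribˡ-* _ _)))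
                                       (sym (-‿distrib-sum (λ b → s a b * pathSum ss b X))))) ⟩
      X a * (chainSum ss + - ∑[ b < d ] (s a b * pathSum ss b X))
        ≈⟨ distribˡ _ _ _ ⟩
      X a * chainSum ss + X a * - ∑[ b < d ] (s a b * pathSum ss b X)
        ≈⟨ +-cong (*-comm _ _) (sym (-‿distribʳ-* _ _)) ⟩
      chainSum ss * X a + - pathSum (s ∷ ss) a X
        ∎
      where open import Algebra.Properties.Ring ring using (-‿distribˡ-*; -‿distribʳ-*)

  alternate : Matrix → Matrix → ℕ → List Matrix
  alternate r s zero    = []
  alternate r s (suc j) = r ∷ s ∷ alternate r s j

  alternate-snoc : ∀ r s j ts → alternate r s j ++ r ∷ s ∷ ts ≡ alternate r s (suc j) ++ ts
  alternate-snoc r s zero    ts = ≡.refl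
  alternate-snoc r s (suc j) ts = ≡.cong (λ z → r ∷ s ∷ z) (alternate-snoc r s j ts)

  alternate-shift : ∀ r s j → r ∷ alternate s r j ≡ alternate r s j ++ r ∷ []
  alternate-shift r s zero    = ≡.refl
  alternate-shift r s (suc j) = ≡.cong (λ z → r ∷ s ∷ z) (alternate-shift r s j)

module Telescoping {c ℓ} (R : CommutativeRing c ℓ) where
  open CommutativeRing R hiding (zero)
  open ≈-Reasoning setoid
  open RangeSum R
  open PowerSeries R using (Seq; _⊛_; atOdd)
  open import Algebra.Properties.Semiring.Exp semiring using (_^_) public
  open import Algebra.Properties.Ring ring using (-‿distribˡ-*; -‿distribʳ-*)
  private module *-Solver = Algebra.Solver.CommutativeMonoid *-commutativeMonoid

  0x+y≈y : ∀ x y → 0# * x + y ≈ y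
  0x+y≈y x y = trans (+-cong (zeroˡ x) refl) (+-identityˡ y)

  recurrence⇒convolution :
    (F : ℕ → ℕ → Carrier) (G : ℕ → Carrier) (C : Seq) →
    (∀ j → F j 0 ≈ G j * C 0) → (∀ j → F j 1 ≈ G j * C 1) →
    (∀ j m → F j (suc (suc m)) ≈ G j * C (suc (suc m)) + F (suc j) m) →
    ∀ m → F 0 m ≈ (atOdd G ⊛ C) (suc m)
  recurrence⇒convolution F G C F₀ F₁ F₂₊ zero          = trans (F₀ 0) (sym (0x+y≈y _ _))
  recurrence⇒convolution F G C F₀ F₁ F₂₊ (suc zero)    =
    trans (F₁ 0) (sym (trans (0x+y≈y _ _) (trans (+-cong refl (zeroˡ _)) (+-identityʳ _))))
  recurrence⇒convolution F G C F₀ F₁ F₂₊ (suc (suc m)) = begin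
    F 0 (suc (suc m))                                         ≈⟨ F₂₊ 0 m ⟩
    G 0 * C (suc (suc m)) + F 1 m                             ≈⟨ +-cong refl shifted ⟩
    G 0 * C (suc (suc m)) + (atOdd (G ∘ suc) ⊛ C) (suc m)     ≈⟨ sym (0x+y≈y _ _) ⟩
    (atOdd G ⊛ C) (suc (suc (suc m)))                         ∎
    where
    shifted : F 1 m ≈ (atOdd (G ∘ suc) ⊛ C) (suc m)
    shifted = recurrence⇒convolution (F ∘ suc) (G ∘ suc) C (F₀ ∘ suc) (F₁ ∘ suc) (F₂₊ ∘ suc) m

  alternating-telescope :
    (E : ℕ → ℕ → Carrier) (P K : ℕ → Carrier) (w u : Carrier) →
    u ≈ - w → P 0 ≈ 1# → (∀ i → E 0 i ≈ K i) →
    (∀ t i → E (suc t) i ≈ P (suc t) * K i - E t (suc i)) →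
    ∀ t i → sum≤ t (λ j → (w ^ j * P j) * (u ^ (t ∸ j) * K (i ℕ.+ (t ∸ j)))) ≈ w ^ t * E t i
  alternating-telescope E P K w u u≈-w P₀ E₀ E₊ zero i = begin
    (1# * P 0) * (1# * K (i ℕ.+ 0))
      ≈⟨ *-cong (trans (*-identityˡ _) P₀) (trans (*-identityˡ _) (reflexive (≡.cong K (ℕP.+-identityʳ i)))) ⟩
    1# * K i
      ≈⟨ *-cong refl (sym (E₀ i)) ⟩
    1# * E 0 i
      ∎
  alternating-telescope E P K w u u≈-w P₀ E₀ E₊ (suc t) i = begin
    sum≤ (suc t) (λ j → (w ^ j * P j) * (u ^ (suc t ∸ j) * K (i ℕ.+ (suc t ∸ j))))
      ≈⟨ sum≤-last t _ ⟩
    sum≤ t (λ j → (w ^ j * P j) * (u ^ (suc t ∸ j) * K (i ℕ.+ (suc t ∸ j))))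
      + (w ^ suc t * P (suc t)) * (u ^ (suc t ∸ suc t) * K (i ℕ.+ (suc t ∸ suc t)))
      ≈⟨ +-cong (sum≤-cong-≤ t pull-u) (*-cong refl last-term) ⟩
    sum≤ t (λ j → u * ((w ^ j * P j) * (u ^ (t ∸ j) * K (suc i ℕ.+ (t ∸ j))))) + (w ^ suc t * P (suc t)) * K i
      ≈⟨ +-cong (sym (*-distribˡ-sum≤ t u _)) refl ⟩
    u * sum≤ t (λ j → (w ^ j * P j) * (u ^ (t ∸ j) * K (suc i ℕ.+ (t ∸ j)))) + (w ^ suc t * P (suc t)) * K i
      ≈⟨ +-cong (*-cong u≈-w (alternating-telescope E P K w u u≈-w P₀ E₀ E₊ t (suc i))) refl ⟩
    - w * (w ^ t * E t (suc i)) + (w ^ suc t * P (suc t)) * K i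
      ≈⟨ +-comm _ _ ⟩
    (w ^ suc t * P (suc t)) * K i + - w * (w ^ t * E t (suc i))
      ≈⟨ +-cong (*-assoc _ _ _)
                (trans (sym (-‿distribˡ-* _ _)) (trans (-‿cong (sym (*-assoc _ _ _))) (-‿distribʳ-* _ _))) ⟩
    w ^ suc t * (P (suc t) * K i) + w ^ suc t * - E t (suc i)
      ≈⟨ sym (distribˡ _ _ _) ⟩
    w ^ suc t * (P (suc t) * K i - E t (suc i))
      ≈⟨ *-cong refl (sym (E₊ t i)) ⟩
    w ^ suc t * E (suc t) i
      ∎
    where
    last-term : u ^ (suc t ∸ suc t) * K (i ℕ.+ (suc t ∸ suc t)) ≈ K i
    last-term = begin
      u ^ (t ∸ t) * K (i ℕ.+ (t ∸ t))  ≈⟨ reflexive (≡.cong (λ k → u ^ k * K (i ℕ.+ k)) (ℕP.n∸n≡0 t)) ⟩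
      1# * K (i ℕ.+ 0)                 ≈⟨ *-identityˡ _ ⟩
      K (i ℕ.+ 0)                      ≈⟨ reflexive (≡.cong K (ℕP.+-identityʳ i)) ⟩
      K i                              ∎
    pull-u : ∀ j → j ≤ t → (w ^ j * P j) * (u ^ (suc t ∸ j) * K (i ℕ.+ (suc t ∸ j)))
                           ≈ u * ((w ^ j * P j) * (u ^ (t ∸ j) * K (suc i ℕ.+ (t ∸ j))))
    pull-u j j≤t = begin
      (w ^ j * P j) * (u ^ (suc t ∸ j) * K (i ℕ.+ (suc t ∸ j)))
        ≈⟨ reflexive (≡.cong (λ k → (w ^ j * P j) * (u ^ k * K (i ℕ.+ k))) (ℕP.+-∸-assoc 1 j≤t)) ⟩
      (w ^ j * P j) * ((u * u ^ (t ∸ j)) * K (i ℕ.+ suc (t ∸ j)))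
        ≈⟨ *-cong refl (*-cong refl (reflexive (≡.cong K (ℕP.+-suc i (t ∸ j))))) ⟩
      (w ^ j * P j) * ((u * u ^ (t ∸ j)) * K (suc i ℕ.+ (t ∸ j)))
        ≈⟨ *-Solver.solve 4 (λ a b c e → a ∙ ((b ∙ c) ∙ e) ⊜ b ∙ (a ∙ (c ∙ e))) refl _ u _ _ ⟩
      u * ((w ^ j * P j) * (u ^ (t ∸ j) * K (suc i ℕ.+ (t ∸ j))))
        ∎
      where open *-Solver using (_⊜_) renaming (_⊕_ to _∙_)

-- The statistic counts the indices i with r₁ σᵢ σᵢ₊₁ and r₂ σᵢ₊₁ σᵢ₊₂ (peaks: r₁ = <, r₂ = >;
-- valleys: r₁ = >, r₂ = <).  As r₂ excludes r₁, no occurrence starts right after another one.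
module PatternCount {c ℓ} (R : CommutativeRing c ℓ) {d : ℕ} (X : Fin d → CommutativeRing.Carrier R)
                    (y : CommutativeRing.Carrier R) (r₁ r₂ : Fin d → Fin d → Bool)
                    (r₂⇒¬r₁ : ∀ b e → r₂ b e ≡ true → r₁ b e ≡ false) where
  open CommutativeRing R hiding (zero)
  open ≈-Reasoning setoid
  open PowerSeries R using (Seq; _≋_; _⊕_; _⊛_; 𝟙; atOdd)
  open FiniteSums R
  open ChainSums R X
  open Telescoping R using (_^_; recurrence⇒convolution)
  private module *-Solver = Algebra.Solver.CommutativeMonoid *-commutativeMonoid

  u : Carrier
  u = y - 1#

  yIf : Bool → Carrier
  yIf true  = y
  yIf false = 1#

  yIf≈1+u·iverson : ∀ t → yIf t ≈ 1# + u * iverson t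
  yIf≈1+u·iverson true  = sym (begin
    1# + (y - 1#) * 1#  ≈⟨ +-cong refl (*-identityʳ _) ⟩
    1# + (y - 1#)       ≈⟨ +-cong refl (+-comm y (- 1#)) ⟩
    1# + (- 1# + y)     ≈⟨ sym (+-assoc _ _ _) ⟩
    (1# - 1#) + y       ≈⟨ +-cong (-‿inverseʳ 1#) refl ⟩
    0# + y              ≈⟨ +-identityˡ y ⟩
    y                   ∎)
  yIf≈1+u·iverson false = sym (trans (+-cong refl (zeroʳ u)) (+-identityʳ 1#))

  weight : List (Fin d) → Carrier
  weight []              = 1#
  weight (a ∷ b ∷ e ∷ τ) = X a * (yIf (r₁ a b ∧ r₂ b e) * weight (b ∷ e ∷ τ))
  weight (a ∷ τ)         = X a * weight τ

  C : ℕ → Carrier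
  C m = wordSum d m weight

  startingWith : ℕ → Fin d → Carrier
  startingWith m e = wordSum d m (λ τ → weight (e ∷ τ))

  ρ₁ ρ₂ : Matrix
  ρ₁ a b = iverson (r₁ a b)
  ρ₂ a b = iverson (r₂ a b)

  weight-expand : ∀ a b e τ → weight (a ∷ b ∷ e ∷ τ) ≈
                  X a * weight (b ∷ e ∷ τ) + u * (X a * (ρ₁ a b * (X b * (ρ₂ b e * weight (e ∷ τ)))))
  weight-expand a b e τ = begin
    X a * (yIf (r₁ a b ∧ r₂ b e) * weight (b ∷ e ∷ τ))
      ≈⟨ *-cong refl (*-cong (trans (yIf≈1+u·iverson (r₁ a b ∧ r₂ b e))
                                    (+-cong refl (*-cong refl (iverson-∧ (r₁ a b) (r₂ b e)))))
                             refl) ⟩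
    X a * ((1# + u * (ρ₁ a b * ρ₂ b e)) * weight (b ∷ e ∷ τ))
      ≈⟨ *-cong refl (distribʳ _ _ _) ⟩
    X a * (1# * weight (b ∷ e ∷ τ) + (u * (ρ₁ a b * ρ₂ b e)) * weight (b ∷ e ∷ τ))
      ≈⟨ distribˡ _ _ _ ⟩
    X a * (1# * weight (b ∷ e ∷ τ)) + X a * ((u * (ρ₁ a b * ρ₂ b e)) * weight (b ∷ e ∷ τ))
      ≈⟨ +-cong (*-cong refl (*-identityˡ _))
                (*-Solver.solve 5 (λ x v p q w → x ∙ ((v ∙ (p ∙ q)) ∙ w) ⊜ v ∙ (x ∙ (p ∙ (q ∙ w))))
                                  refl _ _ _ _ _) ⟩
    X a * weight (b ∷ e ∷ τ) + u * (X a * (ρ₁ a b * (ρ₂ b e * weight (b ∷ e ∷ τ))))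
      ≈⟨ +-cong refl (*-cong refl (*-cong refl (*-cong refl (no-overlap (r₂ b e) ≡.refl)))) ⟩
    X a * weight (b ∷ e ∷ τ) + u * (X a * (ρ₁ a b * (X b * (ρ₂ b e * weight (e ∷ τ)))))
      ∎
    where
    open *-Solver using (_⊜_) renaming (_⊕_ to _∙_)
    no-overlap : ∀ t → r₂ b e ≡ t → iverson t * weight (b ∷ e ∷ τ) ≈ X b * (iverson t * weight (e ∷ τ))
    no-overlap false _   = trans (zeroˡ _) (sym (trans (*-cong refl (zeroˡ _)) (zeroʳ _)))
    no-overlap true  r₂be = trans (*-identityˡ _) (trans (weight-no-occurrence τ) (*-cong refl (sym (*-identityˡ _))))
      where
      weight-no-occurrence : ∀ τ → weight (b ∷ e ∷ τ) ≈ X b * weight (e ∷ τ)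
      weight-no-occurrence []      = refl
      weight-no-occurrence (f ∷ τ) rewrite r₂⇒¬r₁ b e r₂be = *-cong refl (*-identityˡ _)

  wordSum-suc-suc : ∀ m f → wordSum d (suc (suc m)) f ≈ ∑[ b < d ] ∑[ e < d ] wordSum d m (λ τ → f (b ∷ e ∷ τ))
  wordSum-suc-suc m f = trans (wordSum-suc d (suc m) f) (∑-cong (λ b → wordSum-suc d m _))

  startingWith-suc-suc : ∀ m a →
    startingWith (suc (suc m)) a ≈ X a * C (suc (suc m)) + u * pathSum (ρ₁ ∷ ρ₂ ∷ []) a (startingWith m)
  startingWith-suc-suc m a = begin
    startingWith (suc (suc m)) a
      ≈⟨ wordSum-suc-suc m _ ⟩
    ∑[ b < d ] ∑[ e < d ] wordSum d m (λ τ → weight (a ∷ b ∷ e ∷ τ))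
      ≈⟨ ∑-cong (λ b → ∑-cong (λ e → trans (sumOver-cong (words d m) (weight-expand a b e))
                                          (sumOver-distrib-+ (words d m) _ _))) ⟩
    ∑[ b < d ] ∑[ e < d ] (wordSum d m (λ τ → X a * weight (b ∷ e ∷ τ)) + wordSum d m (occurrence b e))
      ≈⟨ trans (∑-cong (λ b → ∑-distrib-+ {d} _ _)) (∑-distrib-+ {d} _ _) ⟩
    ∑[ b < d ] ∑[ e < d ] wordSum d m (λ τ → X a * weight (b ∷ e ∷ τ))
      + ∑[ b < d ] ∑[ e < d ] wordSum d m (occurrence b e)
      ≈⟨ +-cong without-occurrence with-occurrence ⟩
    X a * C (suc (suc m)) + u * pathSum (ρ₁ ∷ ρ₂ ∷ []) a (startingWith m)
      ∎
    where
    occurrence : Fin d → Fin d → List (Fin d) → Carrier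
    occurrence b e τ = u * (X a * (ρ₁ a b * (X b * (ρ₂ b e * weight (e ∷ τ)))))

    without-occurrence : ∑[ b < d ] ∑[ e < d ] wordSum d m (λ τ → X a * weight (b ∷ e ∷ τ)) ≈ X a * C (suc (suc m))
    without-occurrence = begin
      ∑[ b < d ] ∑[ e < d ] wordSum d m (λ τ → X a * weight (b ∷ e ∷ τ))
        ≈⟨ ∑-cong (λ b → ∑-cong (λ e → sym (*-distribˡ-sumOver (words d m) (X a) _))) ⟩
      ∑[ b < d ] ∑[ e < d ] (X a * wordSum d m (λ τ → weight (b ∷ e ∷ τ)))
        ≈⟨ ∑-cong (λ b → sym (*-distribˡ-sum {d} (X a) _)) ⟩
      ∑[ b < d ] (X a * ∑[ e < d ] wordSum d m (λ τ → weight (b ∷ e ∷ τ)))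
        ≈⟨ sym (*-distribˡ-sum {d} (X a) _) ⟩
      X a * ∑[ b < d ] ∑[ e < d ] wordSum d m (λ τ → weight (b ∷ e ∷ τ))
        ≈⟨ *-cong refl (sym (wordSum-suc-suc m weight)) ⟩
      X a * C (suc (suc m))
        ∎

    with-occurrence : ∑[ b < d ] ∑[ e < d ] wordSum d m (occurrence b e) ≈ u * pathSum (ρ₁ ∷ ρ₂ ∷ []) a (startingWith m)
    with-occurrence = begin
      ∑[ b < d ] ∑[ e < d ] wordSum d m (occurrence b e)
        ≈⟨ ∑-cong (λ b → ∑-cong (λ e → sumOver-cong (words d m) (λ τ → *-Solver.solve 6
             (λ v x p z q w → v ∙ (x ∙ (p ∙ (z ∙ (q ∙ w)))) ⊜ (v ∙ (x ∙ (p ∙ z))) ∙ (q ∙ w))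
             refl _ _ _ _ _ _))) ⟩
      ∑[ b < d ] ∑[ e < d ] wordSum d m (λ τ → (u * (X a * (ρ₁ a b * X b))) * (ρ₂ b e * weight (e ∷ τ)))
        ≈⟨ ∑-cong (λ b → ∑-cong (λ e → trans (sym (*-distribˡ-sumOver (words d m) _ _))
                                             (*-cong refl (sym (*-distribˡ-sumOver (words d m) _ _))))) ⟩
      ∑[ b < d ] ∑[ e < d ] ((u * (X a * (ρ₁ a b * X b))) * (ρ₂ b e * startingWith m e))
        ≈⟨ ∑-cong (λ b → sym (*-distribˡ-sum {d} _ _)) ⟩
      ∑[ b < d ] ((u * (X a * (ρ₁ a b * X b))) * ∑[ e < d ] (ρ₂ b e * startingWith m e))
        ≈⟨ ∑-cong (λ b → *-Solver.solve 5 (λ v x p z s → (v ∙ (x ∙ (p ∙ z))) ∙ s ⊜ v ∙ (x ∙ (p ∙ (z ∙ s))))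
                                          refl _ _ _ _ _) ⟩
      ∑[ b < d ] (u * (X a * (ρ₁ a b * (X b * ∑[ e < d ] (ρ₂ b e * startingWith m e)))))
        ≈⟨ sym (*-distribˡ-sum {d} u _) ⟩
      u * ∑[ b < d ] (X a * (ρ₁ a b * (X b * ∑[ e < d ] (ρ₂ b e * startingWith m e))))
        ≈⟨ *-cong refl (sym (*-distribˡ-sum {d} (X a) _)) ⟩
      u * pathSum (ρ₁ ∷ ρ₂ ∷ []) a (startingWith m)
        ∎
      where open *-Solver using (_⊜_) renaming (_⊕_ to _∙_)

  chainTerm : ℕ → Carrier
  chainTerm j = u ^ j * chainSum (alternate ρ₁ ρ₂ j)

  prefixed : ℕ → ℕ → Carrier
  prefixed j m = u ^ j * ∑[ i < d ] pathSum (alternate ρ₁ ρ₂ j) i (startingWith m)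

  prefixed-short : ∀ m → (∀ e → startingWith m e ≈ C m * X e) → ∀ j → prefixed j m ≈ chainTerm j * C m
  prefixed-short m short j = begin
    u ^ j * ∑[ i < d ] pathSum (alternate ρ₁ ρ₂ j) i (startingWith m)
      ≈⟨ *-cong refl (∑-cong (λ i → trans (pathSum-cong (alternate ρ₁ ρ₂ j) i short)
                                          (pathSum-* (alternate ρ₁ ρ₂ j) i (C m) X))) ⟩
    u ^ j * ∑[ i < d ] (C m * pathSum (alternate ρ₁ ρ₂ j) i X)
      ≈⟨ *-cong refl (sym (*-distribˡ-sum {d} (C m) _)) ⟩
    u ^ j * (C m * chainSum (alternate ρ₁ ρ₂ j))
      ≈⟨ x∙yz≈xz∙y _ _ _ ⟩
    chainTerm j * C m
      ∎
    where open import Algebra.Properties.CommutativeSemigroup *-commutativeSemigroup using (x∙yz≈xz∙y)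

  startingWith-0 : ∀ e → startingWith 0 e ≈ C 0 * X e
  startingWith-0 e = begin
    X e * 1# + 0#          ≈⟨ +-identityʳ _ ⟩
    X e * 1#               ≈⟨ *-comm _ _ ⟩
    1# * X e               ≈⟨ *-cong (sym (+-identityʳ 1#)) refl ⟩
    (1# + 0#) * X e        ∎

  startingWith-1 : ∀ e → startingWith 1 e ≈ C 1 * X e
  startingWith-1 e = begin
    startingWith 1 e                   ≈⟨ wordSum-suc d 0 _ ⟩
    ∑[ b < d ] (X e * (X b * 1#) + 0#) ≈⟨ ∑-cong (λ b → trans (+-identityʳ _) (*-cong refl (sym (+-identityʳ _)))) ⟩
    ∑[ b < d ] (X e * (X b * 1# + 0#)) ≈⟨ sym (*-distribˡ-sum {d} (X e) _) ⟩
    X e * ∑[ b < d ] (X b * 1# + 0#)   ≈⟨ *-cong refl (sym (wordSum-suc d 0 weight)) ⟩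
    X e * C 1                          ≈⟨ *-comm _ _ ⟩
    C 1 * X e                          ∎

  prefixed-suc-suc : ∀ j m → prefixed j (suc (suc m)) ≈ chainTerm j * C (suc (suc m)) + prefixed (suc j) m
  prefixed-suc-suc j m = begin
    u ^ j * ∑[ i < d ] pathSum chain i (startingWith (suc (suc m)))
      ≈⟨ *-cong refl (∑-cong extend) ⟩
    u ^ j * ∑[ i < d ] (C (suc (suc m)) * pathSum chain i X + u * pathSum (alternate ρ₁ ρ₂ (suc j)) i (startingWith m))
      ≈⟨ *-cong refl (trans (∑-distrib-+ {d} _ _)
                            (+-cong (sym (*-distribˡ-sum {d} _ _)) (sym (*-distribˡ-sum {d} _ _)))) ⟩
    u ^ j * (C (suc (suc m)) * chainSum chain + u * ∑[ i < d ] pathSum (alternate ρ₁ ρ₂ (suc j)) i (startingWith m))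
      ≈⟨ distribˡ _ _ _ ⟩
    u ^ j * (C (suc (suc m)) * chainSum chain) + u ^ j * (u * ∑[ i < d ] pathSum (alternate ρ₁ ρ₂ (suc j)) i (startingWith m))
      ≈⟨ +-cong (x∙yz≈xz∙y _ _ _) (x∙yz≈yx∙z _ _ _) ⟩
    chainTerm j * C (suc (suc m)) + prefixed (suc j) m
      ∎
    where
    open import Algebra.Properties.CommutativeSemigroup *-commutativeSemigroup using (x∙yz≈xz∙y; x∙yz≈yx∙z)
    chain = alternate ρ₁ ρ₂ j
    extend : ∀ i → pathSum chain i (startingWith (suc (suc m)))
                   ≈ C (suc (suc m)) * pathSum chain i X + u * pathSum (alternate ρ₁ ρ₂ (suc j)) i (startingWith m)
    extend i = begin
      pathSum chain i (startingWith (suc (suc m)))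
        ≈⟨ pathSum-cong chain i (λ e → trans (startingWith-suc-suc m e) (+-cong (*-comm _ _) refl)) ⟩
      pathSum chain i (λ e → C (suc (suc m)) * X e + u * pathSum (ρ₁ ∷ ρ₂ ∷ []) e (startingWith m))
        ≈⟨ pathSum-+ chain i _ _ ⟩
      pathSum chain i (λ e → C (suc (suc m)) * X e) + pathSum chain i (λ e → u * pathSum (ρ₁ ∷ ρ₂ ∷ []) e (startingWith m))
        ≈⟨ +-cong (pathSum-* chain i _ X) (pathSum-* chain i u _) ⟩
      C (suc (suc m)) * pathSum chain i X + u * pathSum chain i (λ e → pathSum (ρ₁ ∷ ρ₂ ∷ []) e (startingWith m))
        ≈⟨ +-cong refl (*-cong refl (trans (sym (pathSum-++ chain (ρ₁ ∷ ρ₂ ∷ []) i (startingWith m)))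
                                           (reflexive (≡.cong (λ rs → pathSum rs i (startingWith m)) chain-snoc)))) ⟩
      C (suc (suc m)) * pathSum chain i X + u * pathSum (alternate ρ₁ ρ₂ (suc j)) i (startingWith m)
        ∎
      where
      chain-snoc : chain ++ ρ₁ ∷ ρ₂ ∷ [] ≡ alternate ρ₁ ρ₂ (suc j)
      chain-snoc = ≡.trans (alternate-snoc ρ₁ ρ₂ j []) (ListP.++-identityʳ _)

  K : Seq
  K = atOdd chainTerm

  C≋𝟙⊕K⊛C : C ≋ 𝟙 ⊕ K ⊛ C
  C≋𝟙⊕K⊛C zero    = +-cong refl (sym (zeroˡ _))
  C≋𝟙⊕K⊛C (suc m) = begin
    C (suc m)                     ≈⟨ wordSum-suc d m weight ⟩
    ∑[ e < d ] startingWith m e   ≈⟨ sym (*-identityˡ _) ⟩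
    prefixed 0 m                  ≈⟨ recurrence⇒convolution prefixed chainTerm C
                                       (prefixed-short 0 startingWith-0) (prefixed-short 1 startingWith-1) prefixed-suc-suc m ⟩
    (K ⊛ C) (suc m)               ≈⟨ sym (+-identityˡ _) ⟩
    (𝟙 ⊕ K ⊛ C) (suc m)           ∎

module AlternatingChains {c ℓ} (R : CommutativeRing c ℓ) {d : ℕ} (X : Fin d → CommutativeRing.Carrier R)
                         (w u : CommutativeRing.Carrier R) (u≈-w : CommutativeRing._≈_ R u (CommutativeRing.-_ R w)) where
  open CommutativeRing R hiding (zero)
  open ≈-Reasoning setoid
  open RangeSum R
  open PowerSeries R using (_≋_; _⊛_; atOdd; atEven; atOdd-cong; atEven-⊛-atOdd)
  open FiniteSums R
  open ChainSums R X
  open Telescoping R using (_^_; alternating-telescope)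

  stepTest : Bool → Fin d → Fin d → Bool
  stepTest strict a b = if strict then does (a <ᶠ? b) else does (a ≤ᶠ? b)

  step : Bool → Matrix
  step strict a b = iverson (stepTest strict a b)

  ρ< ρ> ρ≤ : Matrix
  ρ< = step true
  ρ≤ = step false
  ρ> a b = ρ< b a

  ρ≤≈1-ρ> : ∀ a b → ρ≤ a b ≈ 1# - ρ> a b
  ρ≤≈1-ρ> a b = trans (reflexive (≡.cong iverson ≤≡¬>)) (iverson-not (does (b <ᶠ? a)))
    where
    ≤≡¬> : does (a ≤ᶠ? b) ≡ not (does (b <ᶠ? a))
    ≤≡¬> = does-⇔ (mk⇔ ℕP.≤⇒≯ ℕP.≮⇒≥) (a ≤ᶠ? b) (¬? (b <ᶠ? a))

  zigzag : Bool → ℕ → List Matrix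
  zigzag strict zero    = []
  zigzag strict (suc s) = step strict ∷ zigzag (not strict) s

  -- The X-weighted sum over Pˢ (strict) or Qˢ, i.e. Mˢ(A) or Nˢ(A) without the factor zˢ.
  tupleSum : Bool → ℕ → Carrier
  tupleSum strict zero    = 1#
  tupleSum strict (suc s) = chainSum (zigzag strict s)

  zigzag-<≤ : ∀ t → zigzag true (2 ℕ.* t) ≡ alternate ρ< ρ≤ t
  zigzag-<≤ zero    = ≡.refl
  zigzag-<≤ (suc t) = ≡.trans (≡.cong (zigzag true) (ℕP.*-suc 2 t)) (≡.cong (λ z → ρ< ∷ ρ≤ ∷ z) (zigzag-<≤ t))

  zigzag-≤< : ∀ t → zigzag false (2 ℕ.* t) ≡ alternate ρ≤ ρ< t
  zigzag-≤< zero    = ≡.refl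
  zigzag-≤< (suc t) = ≡.trans (≡.cong (zigzag false) (ℕP.*-suc 2 t)) (≡.cong (λ z → ρ≤ ∷ ρ< ∷ z) (zigzag-≤< t))

  tupleSum-even : ∀ t → tupleSum true (2 ℕ.* suc t) ≈ chainSum (ρ< ∷ alternate ρ≤ ρ< t)
  tupleSum-even t = reflexive (≡.trans (≡.cong (tupleSum true) (ℕP.*-suc 2 t))
                                       (≡.cong (λ z → chainSum (ρ< ∷ z)) (zigzag-≤< t)))

  numeratorSeq : ℕ → Carrier
  numeratorSeq = atEven (λ j → w ^ j * tupleSum true (2 ℕ.* j))

  oddSeq : Bool → ℕ → Carrier
  oddSeq strict = atOdd (λ j → w ^ j * tupleSum strict (suc (2 ℕ.* j)))

  numeratorSeq-⊛-telescope : ∀ strict (K : ℕ → Carrier) (E : ℕ → ℕ → Carrier) →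
    (∀ i → E 0 i ≈ K i) →
    (∀ t i → E (suc t) i ≈ tupleSum true (2 ℕ.* suc t) * K i - E t (suc i)) →
    (∀ t → E t 0 ≈ tupleSum strict (suc (2 ℕ.* t))) →
    numeratorSeq ⊛ atOdd (λ j → u ^ j * K j) ≋ oddSeq strict
  numeratorSeq-⊛-telescope strict K E E₀ E₊ E-end m = trans (atEven-⊛-atOdd _ _ m) (atOdd-cong telescope m)
    where
    telescope : ∀ t → sum≤ t (λ j → (w ^ j * tupleSum true (2 ℕ.* j)) * (u ^ (t ∸ j) * K (t ∸ j)))
                      ≈ w ^ t * tupleSum strict (suc (2 ℕ.* t))
    telescope t = trans (alternating-telescope E (λ j → tupleSum true (2 ℕ.* j)) K w u u≈-w refl E₀ E₊ t 0)
                        (*-cong refl (E-end t))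

  -- E t i sums over the chains <≤…<≤ (t pairs) followed by <>…<> (i pairs); writing the
  -- junction ≤ as 1 − > moves one pair from the first block to the second.
  peak-identity : numeratorSeq ⊛ atOdd (λ j → u ^ j * chainSum (alternate ρ< ρ> j)) ≋ oddSeq true
  peak-identity = numeratorSeq-⊛-telescope true _ E (λ i → refl) E-step E-end
    where
    E : ℕ → ℕ → Carrier
    E t i = chainSum (alternate ρ< ρ≤ t ++ alternate ρ< ρ> i)

    E-step : ∀ t i → E (suc t) i ≈ tupleSum true (2 ℕ.* suc t) * chainSum (alternate ρ< ρ> i) - E t (suc i)
    E-step t i = begin
      chainSum (ρ< ∷ ρ≤ ∷ (alternate ρ< ρ≤ t ++ alternate ρ< ρ> i))
        ≈⟨ reflexive (≡.cong chainSum (≡.sym (≡.trans (ListP.++-assoc (alternate ρ< ρ≤ t) (ρ< ∷ []) _)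
                                                        (alternate-snoc ρ< ρ≤ t _)))) ⟩
      chainSum ((alternate ρ< ρ≤ t ++ ρ< ∷ []) ++ ρ≤ ∷ alternate ρ< ρ> i)
        ≈⟨ chainSum-split (alternate ρ< ρ≤ t ++ ρ< ∷ []) (alternate ρ< ρ> i) ρ≤ ρ> ρ≤≈1-ρ> ⟩
      chainSum (alternate ρ< ρ≤ t ++ ρ< ∷ []) * chainSum (alternate ρ< ρ> i)
        - chainSum ((alternate ρ< ρ≤ t ++ ρ< ∷ []) ++ ρ> ∷ alternate ρ< ρ> i)
        ≈⟨ +-cong (*-cong (sym (trans (tupleSum-even t) (reflexive (≡.cong chainSum (alternate-shift ρ< ρ≤ t)))))
                          refl)
                  (-‿cong (reflexive (≡.cong chainSum (ListP.++-assoc (alternate ρ< ρ≤ t) (ρ< ∷ []) _)))) ⟩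
      tupleSum true (2 ℕ.* suc t) * chainSum (alternate ρ< ρ> i) - E t (suc i)
        ∎

    E-end : ∀ t → E t 0 ≈ tupleSum true (suc (2 ℕ.* t))
    E-end t = reflexive (≡.cong chainSum (≡.trans (ListP.++-identityʳ _) (≡.sym (zigzag-<≤ t))))

  -- Symmetrically, chains ><…>< (i pairs) followed by ≤<…≤< (t pairs).
  valley-identity : numeratorSeq ⊛ atOdd (λ j → u ^ j * chainSum (alternate ρ> ρ< j)) ≋ oddSeq false
  valley-identity = numeratorSeq-⊛-telescope false _ E E₀ E-step E-end
    where
    E : ℕ → ℕ → Carrier
    E t i = chainSum (alternate ρ> ρ< i ++ alternate ρ≤ ρ< t)

    E₀ : ∀ i → E 0 i ≈ chainSum (alternate ρ> ρ< i)
    E₀ i = reflexive (≡.cong chainSum (ListP.++-identityʳ (alternate ρ> ρ< i)))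

    E-step : ∀ t i → E (suc t) i ≈ tupleSum true (2 ℕ.* suc t) * chainSum (alternate ρ> ρ< i) - E t (suc i)
    E-step t i = begin
      chainSum (alternate ρ> ρ< i ++ ρ≤ ∷ ρ< ∷ alternate ρ≤ ρ< t)
        ≈⟨ chainSum-split (alternate ρ> ρ< i) (ρ< ∷ alternate ρ≤ ρ< t) ρ≤ ρ> ρ≤≈1-ρ> ⟩
      chainSum (alternate ρ> ρ< i) * chainSum (ρ< ∷ alternate ρ≤ ρ< t)
        - chainSum (alternate ρ> ρ< i ++ ρ> ∷ ρ< ∷ alternate ρ≤ ρ< t)
        ≈⟨ +-cong (trans (*-comm _ _) (*-cong (sym (tupleSum-even t)) refl))
                  (-‿cong (reflexive (≡.cong chainSum (alternate-snoc ρ> ρ< i _)))) ⟩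
      tupleSum true (2 ℕ.* suc t) * chainSum (alternate ρ> ρ< i) - E t (suc i)
        ∎

    E-end : ∀ t → E t 0 ≈ tupleSum false (suc (2 ℕ.* t))
    E-end t = reflexive (≡.cong chainSum (≡.sym (zigzag-≤< t)))

  monomialOf : List (Fin d) → Carrier
  monomialOf []      = 1#
  monomialOf (i ∷ t) = X i * monomialOf t

  admissibleWeight : Bool → List (Fin d) → Carrier
  admissibleWeight strict t = iverson (altOK strict t) * monomialOf t

  pathSum-zigzag : ∀ strict s i → wordSum d s (λ τ → admissibleWeight strict (i ∷ τ)) ≈ pathSum (zigzag strict s) i X
  pathSum-zigzag strict zero    i = trans (+-identityʳ _) (trans (*-identityˡ _) (*-identityʳ _))
  pathSum-zigzag strict (suc s) i = begin
    wordSum d (suc s) (λ τ → admissibleWeight strict (i ∷ τ))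
      ≈⟨ wordSum-suc d s _ ⟩
    ∑[ j < d ] wordSum d s (λ τ → admissibleWeight strict (i ∷ j ∷ τ))
      ≈⟨ ∑-cong (λ j → sumOver-cong (words d s) (first-step j)) ⟩
    ∑[ j < d ] wordSum d s (λ τ → X i * (step strict i j * admissibleWeight (not strict) (j ∷ τ)))
      ≈⟨ ∑-cong (λ j → trans (sym (*-distribˡ-sumOver (words d s) _ _))
                             (*-cong refl (sym (*-distribˡ-sumOver (words d s) _ _)))) ⟩
    ∑[ j < d ] (X i * (step strict i j * wordSum d s (λ τ → admissibleWeight (not strict) (j ∷ τ))))
      ≈⟨ sym (*-distribˡ-sum {d} (X i) _) ⟩
    X i * ∑[ j < d ] (step strict i j * wordSum d s (λ τ → admissibleWeight (not strict) (j ∷ τ)))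
      ≈⟨ *-cong refl (∑-cong (λ j → *-cong refl (pathSum-zigzag (not strict) s j))) ⟩
    pathSum (zigzag strict (suc s)) i X
      ∎
    where
    module *-Solver = Algebra.Solver.CommutativeMonoid *-commutativeMonoid
    open *-Solver using (_⊜_) renaming (_⊕_ to _∙_)

    first-step : ∀ j τ → admissibleWeight strict (i ∷ j ∷ τ)
                         ≈ X i * (step strict i j * admissibleWeight (not strict) (j ∷ τ))
    first-step j τ = trans (*-cong (iverson-∧ (stepTest strict i j) (altOK (not strict) (j ∷ τ))) refl)
                           (*-Solver.solve 4 (λ p a x q → (p ∙ a) ∙ (x ∙ q) ⊜ x ∙ (p ∙ (a ∙ q))) refl _ _ _ _)

  tupleSum-words : ∀ strict s → tupleSum strict s ≈ wordSum d s (admissibleWeight strict)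
  tupleSum-words strict zero    = sym (trans (+-identityʳ _) (*-identityˡ _))
  tupleSum-words strict (suc s) = trans (∑-cong (λ i → sym (pathSum-zigzag strict s i))) (sym (wordSum-suc d s _))

module FixedPoint {c ℓ} (R : CommutativeRing c ℓ) where
  open CommutativeRing R
  open ≈-Reasoning setoid
  open import Algebra.Properties.Ring ring using (-‿distribˡ-*; -‿distribʳ-*)

  C≈1+KC⇒C[N-NK]≈N : ∀ C K N → C ≈ 1# + K * C → C * (N - N * K) ≈ N
  C≈1+KC⇒C[N-NK]≈N C K N C≈1+KC = begin
    C * (N - N * K)            ≈⟨ distribˡ C N (- (N * K)) ⟩
    C * N + C * - (N * K)      ≈⟨ +-cong refl (sym (-‿distribʳ-* C (N * K))) ⟩
    C * N + - (C * (N * K))    ≈⟨ +-cong refl (-‿cong (x∙yz≈zx∙y C N K)) ⟩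
    C * N + - ((K * C) * N)    ≈⟨ +-cong refl (-‿distribˡ-* (K * C) N) ⟩
    C * N + - (K * C) * N      ≈⟨ sym (distribʳ N C (- (K * C))) ⟩
    (C - K * C) * N            ≈⟨ *-cong C-KC≈1 refl ⟩
    1# * N                     ≈⟨ *-identityˡ N ⟩
    N                          ∎
    where
    open import Algebra.Properties.CommutativeSemigroup *-commutativeSemigroup using (x∙yz≈zx∙y)
    C-KC≈1 : C - K * C ≈ 1#
    C-KC≈1 = begin
      C - K * C                  ≈⟨ +-cong C≈1+KC refl ⟩
      (1# + K * C) - K * C       ≈⟨ +-assoc _ _ _ ⟩
      1# + (K * C - K * C)       ≈⟨ +-cong refl (-‿inverseʳ _) ⟩
      1# + 0#                    ≈⟨ +-identityʳ _ ⟩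
      1#                         ∎

module Coefficients where
  open import Data.Integer as ℤ using (ℤ; +_)
  import Data.Integer.Properties as ℤP

  -- f m n k is the coefficient of zᵐ xⁿ yᵏ in f : ℤ⟦x,y,z⟧, whereas a Series lists its indices as x, y, z.
  ℤ⟦y⟧ ℤ⟦x,y⟧ ℤ⟦x,y,z⟧ : CommutativeRing _ _
  ℤ⟦y⟧     = PowerSeries.powerSeriesRing ℤP.+-*-commutativeRing
  ℤ⟦x,y⟧   = PowerSeries.powerSeriesRing ℤ⟦y⟧
  ℤ⟦x,y,z⟧ = PowerSeries.powerSeriesRing ℤ⟦x,y⟧

  module InY = PowerSeries ℤP.+-*-commutativeRing
  module InX = PowerSeries ℤ⟦y⟧
  module InZ = PowerSeries ℤ⟦x,y⟧
  module ℤ-Sums = RangeSum ℤP.+-*-commutativeRing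
  module XY = CommutativeRing ℤ⟦x,y⟧
  module XY-Sums = RangeSum ℤ⟦x,y⟧

  sum≤-coefficient : ∀ m (F : ℕ → XY.Carrier) n k → XY-Sums.sum≤ m F n k ≡ ℤ-Sums.sum≤ m (λ j → F j n k)
  sum≤-coefficient m F n k = ≡.trans (InX.sum≤-coefficient m F n k) (InY.sum≤-coefficient m _ k)

  sumTo≡sum≤ : ∀ n f → sumTo n f ≡ ℤ-Sums.sum≤ n f
  sumTo≡sum≤ n f = shifted n id
    where
    shifted : ∀ n g → List.foldr (λ i acc → f i ℤ.+ acc) (+ 0) (List.applyUpTo g (suc n)) ≡ ℤ-Sums.sum≤ n (f ∘ g)
    shifted zero    g = ℤP.+-identityʳ _
    shifted (suc n) g = ≡.cong (λ s → f (g 0) ℤ.+ s) (shifted n (g ∘ suc))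

  asSeries : Series → ℕ → ℕ → ℕ → ℤ
  asSeries F m n k = F n k m

  *ₛ-asSeries : ∀ F G n k m → (F *ₛ G) n k m ≡ (asSeries F InZ.⊛ asSeries G) m n k
  *ₛ-asSeries F G n k m = begin
    sumTo n (λ n₁ → sumTo k (λ k₁ → sumTo m (λ m₁ → term n₁ k₁ m₁)))
      ≡⟨ ≡.trans (sumTo≡sum≤ n _) (ℤ-Sums.sum≤-cong n (λ n₁ →
           ≡.trans (sumTo≡sum≤ k _) (ℤ-Sums.sum≤-cong k (λ k₁ → sumTo≡sum≤ m _)))) ⟩
    sum≤ n (λ n₁ → sum≤ k (λ k₁ → sum≤ m (λ m₁ → term n₁ k₁ m₁)))
      ≡⟨ ℤ-Sums.sum≤-cong n (λ n₁ → ℤ-Sums.sum≤-comm k m _) ⟩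
    sum≤ n (λ n₁ → sum≤ m (λ m₁ → sum≤ k (λ k₁ → term n₁ k₁ m₁)))
      ≡⟨ ℤ-Sums.sum≤-comm n m _ ⟩
    sum≤ m (λ m₁ → sum≤ n (λ n₁ → sum≤ k (λ k₁ → term n₁ k₁ m₁)))
      ≡⟨ ≡.sym (ℤ-Sums.sum≤-cong m (λ m₁ → InY.sum≤-coefficient n _ k)) ⟩
    sum≤ m (λ m₁ → (asSeries F m₁ InX.⊛ asSeries G (m ∸ m₁)) n k)
      ≡⟨ ≡.sym (sum≤-coefficient m _ n k) ⟩
    (asSeries F InZ.⊛ asSeries G) m n k
      ∎
    where
    open ≡.≡-Reasoning
    open ℤ-Sums using (sum≤)
    term : ℕ → ℕ → ℕ → ℤ
    term n₁ k₁ m₁ = F n₁ k₁ m₁ ℤ.* G (n ∸ n₁) (k ∸ k₁) (m ∸ m₁)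

  infix 9 x^_y^_
  x^_y^_ : ℕ → ℕ → XY.Carrier
  x^ p y^ q = InX.monomial (InY.monomial (+ 1) q) p

  x^y^-* : ∀ p q p′ q′ → x^ p y^ q XY.* x^ p′ y^ q′ XY.≈ x^ (p ℕ.+ p′) y^ (q ℕ.+ q′)
  x^y^-* p q p′ q′ n = CommutativeRing.trans ℤ⟦y⟧ (InX.monomial-⊛ _ p _ p′ n)
                                                  (InX.monomial-cong (p ℕ.+ p′) (InY.monomial-⊛ (+ 1) q (+ 1) q′) n)

  1≈x^0y^0 : XY.1# XY.≈ x^ 0 y^ 0
  1≈x^0y^0 zero    zero    = ≡.refl
  1≈x^0y^0 zero    (suc k) = ≡.refl
  1≈x^0y^0 (suc n) k       = ≡.refl

  x^y^-coefficient : ∀ p q n k → (x^ p y^ q) n k ≡ (if does ((p ≟ n) ×-dec (q ≟ k)) then + 1 else + 0)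
  x^y^-coefficient p q n k = by-cases (p ≟ n)
    where
    by-cases : (p≟n : Dec (p ≡ n)) →
               InX.onlyIf (does p≟n) (InY.monomial (+ 1) q) k ≡ (if does (p≟n ×-dec (q ≟ k)) then + 1 else + 0)
    by-cases (yes _) = ≡.refl
    by-cases (no  _) = ≡.refl

  x^y^0-coefficient : ∀ p n → (x^ p y^ 0) n 0 ≡ (if does (p ≟ n) then + 1 else + 0)
  x^y^0-coefficient p n = by-cases (p ≟ n)
    where
    by-cases : (p≟n : Dec (p ≡ n)) → InX.onlyIf (does p≟n) (InY.monomial (+ 1) 0) 0 ≡ (if does p≟n then + 1 else + 0)
    by-cases (yes _) = ≡.refl
    by-cases (no  _) = ≡.refl

  x^y^0-coefficient-suc : ∀ p n k → (x^ p y^ 0) n (suc k) ≡ + 0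
  x^y^0-coefficient-suc p n k = by-cases (does (p ≟ n))
    where
    by-cases : ∀ b → InX.onlyIf b (InY.monomial (+ 1) 0) (suc k) ≡ + 0
    by-cases true  = ≡.refl
    by-cases false = ≡.refl

  open FiniteSums ℤ⟦x,y⟧ using (sumOver; sumOver-cong; sumOver-map; iverson)
  module ℤ-Lists = FiniteSums ℤP.+-*-commutativeRing

  sumOver-coefficient : ∀ {A : Set} xs (F : A → XY.Carrier) n k → sumOver xs F n k ≡ ℤ-Lists.sumOver xs (λ x → F x n k)
  sumOver-coefficient []       F n k = ≡.refl
  sumOver-coefficient (x ∷ xs) F n k = ≡.cong (λ s → F x n k ℤ.+ s) (sumOver-coefficient xs F n k)

  sumOver-indicator : ∀ {A : Set} {P : A → Set} (P? : ∀ x → Dec (P x)) (f : A → ℤ) →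
                      (∀ x → f x ≡ (if does (P? x) then + 1 else + 0)) →
                      ∀ xs → ℤ-Lists.sumOver xs f ≡ + List.length (List.filter P? xs)
  sumOver-indicator P? f f≡[P] []       = ≡.refl
  sumOver-indicator P? f f≡[P] (x ∷ xs) with does (P? x) | f≡[P] x
  ... | true  | fx≡1 = ≡.cong₂ ℤ._+_ fx≡1 (sumOver-indicator P? f f≡[P] xs)
  ... | false | fx≡0 = ≡.trans (≡.cong₂ ℤ._+_ fx≡0 (sumOver-indicator P? f f≡[P] xs)) (ℤP.+-identityˡ _)

  sumOver-if : ∀ {A : Set} (p : A → Bool) xs (f : A → ℤ) →
               ℤ-Lists.sumOver xs (λ t → if p t then f t else + 0)
               ≡ ℤ-Lists.sumOver (List.filter (λ t → p t ≟ᵇ true) xs) f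
  sumOver-if p []       f = ≡.refl
  sumOver-if p (x ∷ xs) f with p x
  ... | true  = ≡.cong (λ s → f x ℤ.+ s) (sumOver-if p xs f)
  ... | false = ≡.trans (ℤP.+-identityˡ _) (sumOver-if p xs f)

  module StatisticSeries {d : ℕ} (a : Fin d → ℕ) (r₁ r₂ : Fin d → Fin d → Bool)
    (r₂⇒¬r₁ : ∀ b e → r₂ b e ≡ true → r₁ b e ≡ false) (stat : List ℕ → ℕ)
    (stat-∷ : ∀ i j l τ → stat (List.map a (i ∷ j ∷ l ∷ τ))
                          ≡ (if r₁ i j ∧ r₂ j l then 1 else 0) ℕ.+ stat (List.map a (j ∷ l ∷ τ)))
    (stat-[] : stat [] ≡ 0) (stat-[i] : ∀ i → stat (a i ∷ []) ≡ 0) (stat-[i,j] : ∀ i j → stat (a i ∷ a j ∷ []) ≡ 0)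
    where

    X : Fin d → XY.Carrier
    X i = x^ a i y^ 0

    open PatternCount ℤ⟦x,y⟧ X (x^ 0 y^ 1) r₁ r₂ r₂⇒¬r₁ public
    open XY

    module _ where
      open ≈-Reasoning setoid

      X*x^y^ : ∀ i p q → X i * x^ p y^ q ≈ x^ (a i ℕ.+ p) y^ q
      X*x^y^ i p q = x^y^-* (a i) 0 p q

      yIf≈x^0y^ : ∀ t → yIf t ≈ x^ 0 y^ (if t then 1 else 0)
      yIf≈x^0y^ true  = refl
      yIf≈x^0y^ false = 1≈x^0y^0

      weight≈x^y^ : ∀ σ → weight σ ≈ x^ sumℕ (List.map a σ) y^ stat (List.map a σ)
      weight≈x^y^ [] = trans 1≈x^0y^0 (reflexive (≡.cong (x^ 0 y^_) (≡.sym stat-[])))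
      weight≈x^y^ (i ∷ []) = begin
        X i * 1#                  ≈⟨ *-congˡ {X i} 1≈x^0y^0 ⟩
        X i * x^ 0 y^ 0           ≈⟨ X*x^y^ i 0 0 ⟩
        x^ (a i ℕ.+ 0) y^ 0       ≈⟨ reflexive (≡.cong (x^ (a i ℕ.+ 0) y^_) (≡.sym (stat-[i] i))) ⟩
        x^ (a i ℕ.+ 0) y^ stat (a i ∷ [])  ∎
      weight≈x^y^ (i ∷ j ∷ []) = begin
        X i * weight (j ∷ [])            ≈⟨ *-congˡ {X i} (weight≈x^y^ (j ∷ [])) ⟩
        X i * x^ (a j ℕ.+ 0) y^ stat (a j ∷ [])  ≈⟨ X*x^y^ i (a j ℕ.+ 0) (stat (a j ∷ [])) ⟩
        x^ (a i ℕ.+ (a j ℕ.+ 0)) y^ stat (a j ∷ [])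
          ≈⟨ reflexive (≡.cong (x^ (a i ℕ.+ (a j ℕ.+ 0)) y^_) (≡.trans (stat-[i] j) (≡.sym (stat-[i,j] i j)))) ⟩
        x^ (a i ℕ.+ (a j ℕ.+ 0)) y^ stat (a i ∷ a j ∷ [])  ∎
      weight≈x^y^ (i ∷ j ∷ l ∷ τ) = begin
        X i * (yIf occurs * weight (j ∷ l ∷ τ))
          ≈⟨ *-congˡ {X i} (*-cong (yIf≈x^0y^ occurs) (weight≈x^y^ (j ∷ l ∷ τ))) ⟩
        X i * (x^ 0 y^ [occurs] * x^ sumℕ (List.map a (j ∷ l ∷ τ)) y^ stat (List.map a (j ∷ l ∷ τ)))
          ≈⟨ *-congˡ {X i} (x^y^-* 0 [occurs] (sumℕ (List.map a (j ∷ l ∷ τ))) (stat (List.map a (j ∷ l ∷ τ)))) ⟩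
        X i * x^ sumℕ (List.map a (j ∷ l ∷ τ)) y^ ([occurs] ℕ.+ stat (List.map a (j ∷ l ∷ τ)))
          ≈⟨ X*x^y^ i (sumℕ (List.map a (j ∷ l ∷ τ))) ([occurs] ℕ.+ stat (List.map a (j ∷ l ∷ τ))) ⟩
        x^ sumℕ (List.map a (i ∷ j ∷ l ∷ τ)) y^ ([occurs] ℕ.+ stat (List.map a (j ∷ l ∷ τ)))
          ≈⟨ reflexive (≡.cong (x^ sumℕ (List.map a (i ∷ j ∷ l ∷ τ)) y^_) (≡.sym (stat-∷ i j l τ))) ⟩
        x^ sumℕ (List.map a (i ∷ j ∷ l ∷ τ)) y^ stat (List.map a (i ∷ j ∷ l ∷ τ))
          ∎
        where
        occurs = r₁ i j ∧ r₂ j l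
        [occurs] = if occurs then 1 else 0

    Cstat≡C : ∀ m n k → Cstat stat a n k m ≡ C m n k
    Cstat≡C m n k = ≡.sym (begin
      sumOver (words d m) weight n k
        ≡⟨ sumOver-cong (words d m) weight≈x^y^ n k ⟩
      sumOver (words d m) (λ t → x^ sumℕ (List.map a t) y^ stat (List.map a t)) n k
        ≡⟨ ≡.sym (sumOver-map (List.map a) (words d m) (λ σ → x^ sumℕ σ y^ stat σ) n k) ⟩
      sumOver (compositions a m) (λ σ → x^ sumℕ σ y^ stat σ) n k
        ≡⟨ sumOver-coefficient (compositions a m) _ n k ⟩
      ℤ-Lists.sumOver (compositions a m) (λ σ → (x^ sumℕ σ y^ stat σ) n k)
        ≡⟨ sumOver-indicator (λ σ → (sumℕ σ ≟ n) ×-dec (stat σ ≟ k)) _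
                             (λ σ → x^y^-coefficient (sumℕ σ) (stat σ) n k) (compositions a m) ⟩
      Cstat stat a n k m
        ∎)
      where open ≡.≡-Reasoning

  w : XY.Carrier
  w n k = oneMinusY n k 0

  y-1≈-w : x^ 0 y^ 1 XY.- XY.1# XY.≈ XY.- w
  y-1≈-w zero    zero          = ≡.refl
  y-1≈-w zero    (suc zero)    = ≡.refl
  y-1≈-w zero    (suc (suc k)) = ≡.refl
  y-1≈-w (suc n) zero          = ≡.refl
  y-1≈-w (suc n) (suc k)       = ≡.refl

  oneₛ≡constant : ∀ m n k → oneₛ n k m ≡ InZ.constant XY.1# m n k
  oneₛ≡constant zero    zero    zero    = ≡.refl
  oneₛ≡constant zero    zero    (suc k) = ≡.refl
  oneₛ≡constant zero    (suc n) k       = ≡.refl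
  oneₛ≡constant (suc m) zero    zero    = ≡.refl
  oneₛ≡constant (suc m) zero    (suc k) = ≡.refl
  oneₛ≡constant (suc m) (suc n) k       = ≡.refl

  constant-1#≡𝟙 : ∀ m → InZ.constant XY.1# m ≡ InZ.𝟙 m
  constant-1#≡𝟙 zero    = ≡.refl
  constant-1#≡𝟙 (suc m) = ≡.refl

  oneMinusY≡constant : ∀ m n k → oneMinusY n k m ≡ InZ.constant w m n k
  oneMinusY≡constant zero    n       k             = ≡.refl
  oneMinusY≡constant (suc m) zero    zero          = ≡.refl
  oneMinusY≡constant (suc m) zero    (suc zero)    = ≡.refl
  oneMinusY≡constant (suc m) zero    (suc (suc k)) = ≡.refl
  oneMinusY≡constant (suc m) (suc n) k             = ≡.refl

  open Telescoping ℤ⟦x,y⟧ using (_^_)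

  oneMinusY^≡constant : ∀ j m n k → (oneMinusY ^ₛ j) n k m ≡ InZ.constant (w ^ j) m n k
  oneMinusY^≡constant zero    m n k = oneₛ≡constant m n k
  oneMinusY^≡constant (suc j) m n k = begin
    (oneMinusY *ₛ (oneMinusY ^ₛ j)) n k m
      ≡⟨ *ₛ-asSeries oneMinusY (oneMinusY ^ₛ j) n k m ⟩
    (asSeries oneMinusY InZ.⊛ asSeries (oneMinusY ^ₛ j)) m n k
      ≡⟨ InZ.⊛-cong {asSeries oneMinusY} {InZ.constant w} {asSeries (oneMinusY ^ₛ j)} {InZ.constant (w ^ j)}
                    oneMinusY≡constant (oneMinusY^≡constant j) m n k ⟩
    (InZ.constant w InZ.⊛ InZ.constant (w ^ j)) m n k
      ≡⟨ InZ.monomial-⊛ w 0 (w ^ j) 0 m n k ⟩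
    InZ.constant (w ^ suc j) m n k
      ∎
    where open ≡.≡-Reasoning

  module Tuples {d : ℕ} (a : Fin d → ℕ) where

    X : Fin d → XY.Carrier
    X i = x^ a i y^ 0

    open AlternatingChains ℤ⟦x,y⟧ X w (x^ 0 y^ 1 XY.- XY.1#) y-1≈-w public

    x^Σa : List (Fin d) → XY.Carrier
    x^Σa t = x^ sumℕ (List.map a t) y^ 0

    monomialOf≈x^Σa : ∀ t → monomialOf t XY.≈ x^Σa t
    monomialOf≈x^Σa []      = 1≈x^0y^0
    monomialOf≈x^Σa (i ∷ t) = XY.trans (XY.*-congˡ {X i} (monomialOf≈x^Σa t)) (x^y^-* (a i) 0 (sumℕ (List.map a t)) 0)

    iverson-*≈onlyIf : ∀ b {x y} → x XY.≈ y → iverson b XY.* x XY.≈ InZ.onlyIf b y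
    iverson-*≈onlyIf true  {x} x≈y = XY.trans (XY.*-identityˡ x) x≈y
    iverson-*≈onlyIf false {x} x≈y = XY.zeroˡ x

    module _ (strict : Bool) where

      tuples : ℕ → Series
      tuples = tupleSeries (λ {d′} → altOK {d′} strict) a

      admissible : ℕ → List (List (Fin d))
      admissible s = List.filter (λ t → altOK strict t ≟ᵇ true) (words d s)

      tupleSum≈sumOver-onlyIf : ∀ s → tupleSum strict s XY.≈ sumOver (words d s) (λ t → InZ.onlyIf (altOK strict t) (x^Σa t))
      tupleSum≈sumOver-onlyIf s = XY.trans (tupleSum-words strict s)
                             (sumOver-cong (words d s) (λ t → iverson-*≈onlyIf (altOK strict t) (monomialOf≈x^Σa t)))

      tupleSum-coefficient : ∀ s n →
        tupleSum strict s n 0 ≡ + List.length (List.filter (λ t → sumℕ (List.map a t) ≟ n) (admissible s))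
      tupleSum-coefficient s n = begin
        tupleSum strict s n 0
          ≡⟨ tupleSum≈sumOver-onlyIf s n 0 ⟩
        sumOver (words d s) (λ t → InZ.onlyIf (altOK strict t) (x^Σa t)) n 0
          ≡⟨ sumOver-coefficient (words d s) _ n 0 ⟩
        ℤ-Lists.sumOver (words d s) (λ t → InZ.onlyIf (altOK strict t) (x^Σa t) n 0)
          ≡⟨ ℤ-Lists.sumOver-cong (words d s) (λ t → onlyIf-coefficient (altOK strict t)) ⟩
        ℤ-Lists.sumOver (words d s) (λ t → if altOK strict t then (x^Σa t) n 0 else + 0)
          ≡⟨ sumOver-if (altOK strict) (words d s) _ ⟩
        ℤ-Lists.sumOver (admissible s) (λ t → (x^Σa t) n 0)
          ≡⟨ sumOver-indicator (λ t → sumℕ (List.map a t) ≟ n) _ (λ t → x^y^0-coefficient (sumℕ (List.map a t)) n)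
                               (admissible s) ⟩
        + List.length (List.filter (λ t → sumℕ (List.map a t) ≟ n) (admissible s))
          ∎
        where
        open ≡.≡-Reasoning
        onlyIf-coefficient : ∀ b {f : XY.Carrier} → InZ.onlyIf b f n 0 ≡ (if b then f n 0 else + 0)
        onlyIf-coefficient true  = ≡.refl
        onlyIf-coefficient false = ≡.refl

      tupleSum-coefficient-suc : ∀ s n k → tupleSum strict s n (suc k) ≡ + 0
      tupleSum-coefficient-suc s n k =
        ≡.trans (tupleSum≈sumOver-onlyIf s n (suc k))
                (≡.trans (sumOver-coefficient (words d s) _ n (suc k))
                         (ℤ-Lists.sumOver-zero (words d s) (λ t → vanishes (altOK strict t) (sumℕ (List.map a t)))))
        where
        vanishes : ∀ b p → InZ.onlyIf b (x^ p y^ 0) n (suc k) ≡ + 0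
        vanishes true  p = x^y^0-coefficient-suc p n k
        vanishes false p = ≡.refl

      tuples≡onlyIf : ∀ s m n k → tuples s n k m ≡ InZ.onlyIf (does (m ≟ s)) (tupleSum strict s) n k
      tuples≡onlyIf s m n zero = by-cases (does (m ≟ s))
        where
        by-cases : ∀ b → (if b then + List.length (List.filter (λ t → sumℕ (List.map a t) ≟ n) (admissible s))
                                else + 0)
                         ≡ InZ.onlyIf b (tupleSum strict s) n zero
        by-cases true  = ≡.sym (tupleSum-coefficient s n)
        by-cases false = ≡.refl
      tuples≡onlyIf s m n (suc k) = by-cases (does (m ≟ s))
        where
        by-cases : ∀ b → + 0 ≡ InZ.onlyIf b (tupleSum strict s) n (suc k)
        by-cases true  = ≡.sym (tupleSum-coefficient-suc s n k)
        by-cases false = ≡.refl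

      tuples*ₛpower : ∀ s j m n k →
        (tuples s *ₛ (oneMinusY ^ₛ j)) n k m ≡ InZ.onlyIf (does (m ≟ s)) (w ^ j XY.* tupleSum strict s) n k
      tuples*ₛpower s j m n k = begin
        (tuples s *ₛ (oneMinusY ^ₛ j)) n k m
          ≡⟨ *ₛ-asSeries (tuples s) (oneMinusY ^ₛ j) n k m ⟩
        (asSeries (tuples s) InZ.⊛ asSeries (oneMinusY ^ₛ j)) m n k
          ≡⟨ InZ.⊛-cong {asSeries (tuples s)} {degree-s} {asSeries (oneMinusY ^ₛ j)} {InZ.constant (w ^ j)}
                        (tuples≡onlyIf s) (oneMinusY^≡constant j) m n k ⟩
        (degree-s InZ.⊛ InZ.constant (w ^ j)) m n k
          ≡⟨ InZ.⊛-constant degree-s (w ^ j) m n k ⟩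
        (InZ.onlyIf (does (m ≟ s)) (tupleSum strict s) XY.* w ^ j) n k
          ≡⟨ InZ.onlyIf-*ʳ (does (m ≟ s)) (tupleSum strict s) (w ^ j) n k ⟩
        InZ.onlyIf (does (m ≟ s)) (tupleSum strict s XY.* w ^ j) n k
          ≡⟨ InZ.onlyIf-cong (does (m ≟ s)) (XY.*-comm (tupleSum strict s) (w ^ j)) n k ⟩
        InZ.onlyIf (does (m ≟ s)) (w ^ j XY.* tupleSum strict s) n k
          ∎
        where
        open ≡.≡-Reasoning
        degree-s : InZ.Seq
        degree-s m = InZ.onlyIf (does (m ≟ s)) (tupleSum strict s)

      oddSum≡oddSeq : ∀ m n k → oddSum tuples n k m ≡ oddSeq strict m n k
      oddSum≡oddSeq m n k = begin
        sumTo m (λ j → (tuples (suc (2 ℕ.* j)) *ₛ (oneMinusY ^ₛ j)) n k m)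
          ≡⟨ sumTo≡sum≤ m _ ⟩
        ℤ-Sums.sum≤ m (λ j → (tuples (suc (2 ℕ.* j)) *ₛ (oneMinusY ^ₛ j)) n k m)
          ≡⟨ ℤ-Sums.sum≤-cong m (λ j → tuples*ₛpower (suc (2 ℕ.* j)) j m n k) ⟩
        ℤ-Sums.sum≤ m (λ j → InZ.onlyIf (does (m ≟ suc (2 ℕ.* j))) (w ^ j XY.* tupleSum strict (suc (2 ℕ.* j))) n k)
          ≡⟨ ≡.sym (sum≤-coefficient m _ n k) ⟩
        XY-Sums.sum≤ m (λ j → InZ.onlyIf (does (m ≟ suc (2 ℕ.* j))) (w ^ j XY.* tupleSum strict (suc (2 ℕ.* j)))) n k
          ≡⟨ InZ.sum≤-onlyIf-odd _ m n k ⟩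
        oddSeq strict m n k
          ∎
        where open ≡.≡-Reasoning

    numerator≡numeratorSeq : ∀ m n k → numerator a n k m ≡ numeratorSeq m n k
    numerator≡numeratorSeq m n k = begin
      oneₛ n k m ℤ.+ sumTo m (λ j → (tuples true (2 ℕ.* suc j) *ₛ (oneMinusY ^ₛ suc j)) n k m)
        ≡⟨ ≡.cong₂ ℤ._+_ (≡.trans (oneₛ≡constant m n k) (≡.cong (λ f → f n k) (constant-1#≡𝟙 m)))
                         (≡.trans (sumTo≡sum≤ m _)
                                  (ℤ-Sums.sum≤-cong m (λ j → tuples*ₛpower true (2 ℕ.* suc j) (suc j) m n k))) ⟩
      InZ.𝟙 m n k ℤ.+ ℤ-Sums.sum≤ m (λ j → InZ.onlyIf (does (m ≟ 2 ℕ.* suc j)) (even (suc j)) n k)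
        ≡⟨ ≡.cong (λ s → InZ.𝟙 m n k ℤ.+ s) (≡.sym (sum≤-coefficient m _ n k)) ⟩
      InZ.𝟙 m n k ℤ.+ XY-Sums.sum≤ m (λ j → InZ.onlyIf (does (m ≟ 2 ℕ.* suc j)) (even (suc j))) n k
        ≡⟨ InZ.𝟙+sum≤-onlyIf-even even (XY.*-identityˡ XY.1#) m n k ⟩
      numeratorSeq m n k
        ∎
      where
      open ≡.≡-Reasoning
      even : ℕ → XY.Carrier
      even j = w ^ j XY.* tupleSum true (2 ℕ.* j)

    product-formula : ∀ strict (Cs : Series) (C K : InZ.Seq) →
      (∀ m n k → Cs n k m ≡ C m n k) → C InZ.≋ InZ.𝟙 InZ.⊕ K InZ.⊛ C →
      numeratorSeq InZ.⊛ K InZ.≋ oddSeq strict →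
      (Cs *ₛ (numerator a -ₛ oddSum (tuples strict))) ≈ₛ numerator a
    product-formula strict Cs C K Cs≡C C≋𝟙⊕KC NK≋odd n k m = begin
      (Cs *ₛ (numerator a -ₛ oddSum (tuples strict))) n k m
        ≡⟨ *ₛ-asSeries Cs (numerator a -ₛ oddSum (tuples strict)) n k m ⟩
      (asSeries Cs InZ.⊛ asSeries (numerator a -ₛ oddSum (tuples strict))) m n k
        ≡⟨ InZ.⊛-cong {asSeries Cs} {C} {asSeries (numerator a -ₛ oddSum (tuples strict))}
                      {numeratorSeq InZ.⊕ InZ.⊖ (numeratorSeq InZ.⊛ K)} Cs≡C denominator m n k ⟩
      (C InZ.⊛ (numeratorSeq InZ.⊕ InZ.⊖ (numeratorSeq InZ.⊛ K))) m n k
        ≡⟨ FixedPoint.C≈1+KC⇒C[N-NK]≈N ℤ⟦x,y,z⟧ C K numeratorSeq C≋𝟙⊕KC m n k ⟩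
      numeratorSeq m n k
        ≡⟨ ≡.sym (numerator≡numeratorSeq m n k) ⟩
      numerator a n k m
        ∎
      where
      open ≡.≡-Reasoning
      denominator : ∀ m n k → (numerator a -ₛ oddSum (tuples strict)) n k m
                              ≡ (numeratorSeq InZ.⊕ InZ.⊖ (numeratorSeq InZ.⊛ K)) m n k
      denominator m n k = ≡.cong₂ ℤ._-_ (numerator≡numeratorSeq m n k)
                                        (≡.trans (oddSum≡oddSeq strict m n k) (≡.sym (NK≋odd m n k)))

  module StrictlyIncreasing {d : ℕ} (a : Fin d → ℕ) (a-mono : ∀ i j → i <ᶠ j → a i < a j) where
    open Tuples a

    does-a<a : ∀ i j → does (a i ℕ.<? a j) ≡ does (i <ᶠ? j)
    does-a<a i j = does-⇔ (mk⇔ reflect (a-mono i j)) (a i ℕ.<? a j) (i <ᶠ? j)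
      where
      reflect : a i < a j → i <ᶠ j
      reflect ai<aj with FinP.<-cmp i j
      ... | tri< i<j _ _ = i<j
      ... | tri≈ _ ≡.refl _ = ⊥-elim (ℕP.<-irrefl ≡.refl ai<aj)
      ... | tri> _ _ j<i = ⊥-elim (ℕP.<-asym ai<aj (a-mono j i j<i))

    <ᶠ-asym : ∀ (b e : Fin d) → does (e <ᶠ? b) ≡ true → does (b <ᶠ? e) ≡ false
    <ᶠ-asym b e e<b = dec-false (b <ᶠ? e) (λ b<e → ℕP.<-asym b<e (witness (e <ᶠ? b) e<b))
      where
      witness : ∀ {A : Set} (a? : Dec A) → does a? ≡ true → A
      witness (yes p) _ = p

    peaks-∷ : ∀ i j l τ → peaks (List.map a (i ∷ j ∷ l ∷ τ))
              ≡ (if does (i <ᶠ? j) ∧ does (l <ᶠ? j) then 1 else 0) ℕ.+ peaks (List.map a (j ∷ l ∷ τ))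
    peaks-∷ i j l τ rewrite does-a<a i j | does-a<a l j = ≡.refl

    valleys-∷ : ∀ i j l τ → valleys (List.map a (i ∷ j ∷ l ∷ τ))
                ≡ (if does (j <ᶠ? i) ∧ does (j <ᶠ? l) then 1 else 0) ℕ.+ valleys (List.map a (j ∷ l ∷ τ))
    valleys-∷ i j l τ rewrite does-a<a j i | does-a<a j l = ≡.refl

    module Peaks = StatisticSeries a (λ i j → does (i <ᶠ? j)) (λ j l → does (l <ᶠ? j)) <ᶠ-asym
                                   peaks peaks-∷ ≡.refl (λ _ → ≡.refl) (λ _ _ → ≡.refl)

    module Valleys = StatisticSeries a (λ i j → does (j <ᶠ? i)) (λ j l → does (j <ᶠ? l)) (λ b e → <ᶠ-asym e b)
                                     valleys valleys-∷ ≡.refl (λ _ → ≡.refl) (λ _ _ → ≡.refl)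

    peak-formula : (Cpeak a *ₛ denPeak a) ≈ₛ numerator a
    peak-formula =
      product-formula true (Cpeak a) Peaks.C Peaks.K Peaks.Cstat≡C Peaks.C≋𝟙⊕K⊛C peak-identity

    valley-formula : (Cvalley a *ₛ denValley a) ≈ₛ numerator a
    valley-formula =
      product-formula false (Cvalley a) Valleys.C Valleys.K Valleys.Cstat≡C Valleys.C≋𝟙⊕K⊛C valley-identity

theorem4 : (d : ℕ) (a : Fin d → ℕ)
    → (∀ i → 0 < a i)
    → (∀ i j → i <ᶠ j → a i < a j)
    → ((Cpeak a *ₛ denPeak a) ≈ₛ numerator a)
    × ((Cvalley a *ₛ denValley a) ≈ₛ numerator a)
theorem4 d a _ a-mono = peak-formula , valley-formula
  where
  open Coefficients.StrictlyIncreasing a a-mono
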